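{- Fix $i<2$. Let $p$ be a pattern of size at least $2$ such that every sub-pattern of $p$ is reducible, convergent, or not $i$-merging, and let $f:[\mathbb{N}]^2\to 2$ be a stable computable coloring. Then for every infinite set $H$ such that $\mathcal{H}_i(f)$ is 2-dimensional $H$-hyperimmune, the pattern $p$ strongly $f$-appears in $H$.
   Context: A coloring $f:[\mathbb{N}]^2\to2$ is stable if $\lim_y f(x,y)$ exists for every $x$. For sets $E<F$, write $E\to_j F$ if $f(x,y)=j$ for all $x\in E,y\in F$. Let $A_j(f)=\{x:\forall^\infty y\, f(x,y)=j\}$, and let $\mathcal{H}_i(f)$ be the collection of all pairs $(E,F)$ of finite sets with $E<F$, $E\subseteq A_i(f)$, $F\subseteq A_{1-i}(f)$ and $E\to_{1-i}F$. A pattern is a function $p:[\ell]^2\to 2$, $\ell\ge1$, on unordered pairs from $\{0,\dots,\ell-1\}$; write $p(x,y)$ for $x<y$; $p^-$ is its restriction to $[\ell-1]^2$. A set $\{x_0<\dots<x_{k-1}\}$ $f$-realizes a pattern $q$ of length $k$ if $f(x_a,x_b)=q(a,b)$ for all $a<b<k$. A finite set $F=\{x_0<\dots<x_{\ell-2}\}$ strongly $f$-realizes $p$ if it $f$-realizes $p^-$ and for each $a<\ell-1$, $f(x_a,y)=p(a,\ell-1)$ for all but finitely many $y$; $p$ strongly $f$-appears in $H$ if some finite $F\subseteq H$ strongly $f$-realizes $p$. Sub-pattern: injective $g$ with $q(x,y)=p(g(x),g(y))$ for distinct $x,y<|q|$. Join: $p\uplus q$ has length $|p|+|q|-1$, with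 $(p\uplus q)(x,y)=p(x,y)$ if $y<|p|$; $=q(x-|p|+1,y-|p|+1)$ if $x\ge|p|-1$; $=p(x,|p|-1)$ if $x<|p|-1<y$. Reducible: equals $p\uplus q$ with $|p|,|q|\ge2$. Convergent: $x\mapsto p(x,\ell-1)$ constant on $\{0,\dots,\ell-2\}$. $p$ is $i$-merging if for every partition $F\sqcup G=\{0,\dots,\ell-2\}$ into two non-empty sets with $F<G$, one of: (1) some $x\in F$ has $p(x,\ell-1)=1-i$; (2) some $x\in G$ has $p(x,\ell-1)=i$; (3) there are $x_0,x_1\in F$, $y_0,y_1\in G$ with $p(x_0,y_0)\ne p(x_1,y_1)$. A bi-array is a collection $\langle E_n,F_{n,m}\rangle_{n,m}$ of non-empty finite sets with $\min E_n>n$, $\min F_{n,m}>m$; it meets a collection $\mathcal{H}$ if $(E_n,F_{n,m})\in\mathcal{H}$ for some $n,m$. $\mathcal{H}$ is 2-dimensional $C$-hyperimmune if every $C$-computable bi-array meets $\mathcal{H}$. -}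

module Defs where

open import Data.Nat using (ℕ; zero; suc; _+_; _∸_; _≤_; _<_; _/_; _%_; _≡ᵇ_)
open import Data.Bool using (Bool; true; false; not; if_then_else_)
open import Data.Fin using (Fin)
open import Data.Vec using (Vec; []; _∷_; lookup)
open import Data.Product using (Σ; ∃; _×_; _,_)
open import Data.Sum using (_⊎_)
open import Relation.Nullary using (¬_; does)
open import Relation.Binary.PropositionalEquality using (_≡_; _≢_)
open import Data.Nat using (_<?_)

data Code : ℕ → Set where
  zer  : ∀ {n} → Code n
  succ : Code 1
  proj : ∀ {n} → Fin n → Code n
  comp : ∀ {n k} → Code k → Vec (Code n) k → Code n
  prec : ∀ {n} → Code n → Code (suc (suc n)) → Code (suc n)
  mu   : ∀ {n} → Code (suc n) → Code n
  orc  : Code 1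

bool→ℕ : Bool → ℕ
bool→ℕ true  = 1
bool→ℕ false = 0

mutual
  data Eval (O : ℕ → Bool) : ∀ {n} → Code n → Vec ℕ n → ℕ → Set where
    e-zer  : ∀ {n} {xs : Vec ℕ n} → Eval O zer xs 0
    e-succ : ∀ {x} → Eval O succ (x ∷ []) (suc x)
    e-proj : ∀ {n} {i : Fin n} {xs} → Eval O (proj i) xs (lookup xs i)
    e-comp : ∀ {n k} {c : Code k} {cs : Vec (Code n) k} {xs ys v} →
             EvalV O cs xs ys → Eval O c ys v → Eval O (comp c cs) xs v
    e-prec0 : ∀ {n} {g : Code n} {s : Code (suc (suc n))} {xs v} →
              Eval O g xs v → Eval O (prec g s) (0 ∷ xs) v
    e-precS : ∀ {n} {g : Code n} {s : Code (suc (suc n))} {k xs u v} →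
              Eval O (prec g s) (k ∷ xs) u → Eval O s (k ∷ u ∷ xs) v →
              Eval O (prec g s) (suc k ∷ xs) v
    e-mu   : ∀ {n} {c : Code (suc n)} {xs k} →
             Eval O c (k ∷ xs) 0 →
             (∀ j → j < k → ∃ λ v → Eval O c (j ∷ xs) (suc v)) →
             Eval O (mu c) xs k
    e-orc  : ∀ {x} → Eval O orc (x ∷ []) (bool→ℕ (O x))

  data EvalV (O : ℕ → Bool) : ∀ {n k} → Vec (Code n) k → Vec ℕ n → Vec ℕ k → Set where
    ev-[] : ∀ {n} {xs : Vec ℕ n} → EvalV O [] xs []
    ev-∷  : ∀ {n k} {c : Code n} {cs : Vec (Code n) k} {xs y ys} →
            Eval O c xs y → EvalV O cs xs ys → EvalV O (c ∷ cs) xs (y ∷ ys)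

Computable₁ : (ℕ → Bool) → (ℕ → ℕ) → Set
Computable₁ O g = Σ (Code 1) λ c → ∀ x → Eval O c (x ∷ []) (g x)

Computable₂ : (ℕ → Bool) → (ℕ → ℕ → ℕ) → Set
Computable₂ O g = Σ (Code 2) λ c → ∀ x y → Eval O c (x ∷ y ∷ []) (g x y)

emptyOracle : ℕ → Bool
emptyOracle _ = false

-- A set H ⊆ ℕ is given by its characteristic function.
Infinite : (ℕ → Bool) → Set
Infinite H = ∀ n → ∃ λ m → n ≤ m × H m ≡ true

-- A coloring of [ℕ]² : only the values f x y with x < y are meaningful.
Coloring : Set
Coloring = ℕ → ℕ → Bool

ComputableColoring : Coloring → Set
ComputableColoring f =
  Σ (Code 2) λ c → ∀ x y → x < y → Eval emptyOracle c (x ∷ y ∷ []) (bool→ℕ (f x y))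

Cofinitely : (ℕ → Set) → Set
Cofinitely P = ∃ λ N → ∀ y → N < y → P y

Stable : Coloring → Set
Stable f = ∀ x → ∃ λ j → Cofinitely (λ y → f x y ≡ j)

A : Coloring → Bool → ℕ → Set
A f j x = Cofinitely (λ y → f x y ≡ j)

-- Finite sets via canonical codes: i ∈ D_k iff bit i of k is 1.

bit : ℕ → ℕ → Bool
bit k zero    = (k % 2) ≡ᵇ 1
bit k (suc i) = bit (k / 2) i

_∈D_ : ℕ → ℕ → Set
i ∈D k = bit k i ≡ true

InH : Bool → Coloring → ℕ → ℕ → Set
InH i f e d =
  (∀ x y → x ∈D e → y ∈D d → x < y) ×
  (∀ x → x ∈D e → A f i x) ×
  (∀ y → y ∈D d → A f (not i) y) ×
  (∀ x y → x ∈D e → y ∈D d → f x y ≡ not i)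

BiArray : (ℕ → ℕ) → (ℕ → ℕ → ℕ) → Set
BiArray e d =
  (∀ n → ∃ λ x → x ∈D e n) ×
  (∀ n → ∀ x → x ∈D e n → n < x) ×
  (∀ n m → ∃ λ y → y ∈D d n m) ×
  (∀ n m → ∀ y → y ∈D d n m → m < y)

Meets : (ℕ → ℕ) → (ℕ → ℕ → ℕ) → Bool → Coloring → Set
Meets e d i f = ∃ λ n → ∃ λ m → InH i f (e n) (d n m)

TwoDimHyperimmune : (C : ℕ → Bool) → Bool → Coloring → Set
TwoDimHyperimmune C i f =
  ∀ (e : ℕ → ℕ) (d : ℕ → ℕ → ℕ) →
    BiArray e d → Computable₁ C e → Computable₂ C d → Meets e d i f

record Pattern : Set where
  constructor pat
  field
    len : ℕ
    col : ℕ → ℕ → Bool   -- col x y meaningful only for x < y < len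
open Pattern public

-- value on the unordered pair {a, b} (a ≢ b)
symcol : Pattern → ℕ → ℕ → Bool
symcol p a b = if does (a <? b) then col p a b else col p b a

_≈P_ : Pattern → Pattern → Set
p ≈P q = len p ≡ len q × (∀ x y → x < y → y < len p → col p x y ≡ col q x y)

SubPattern : Pattern → Pattern → Set
SubPattern q p = Σ (ℕ → ℕ) λ g →
  (∀ x → x < len q → g x < len p) ×
  (∀ x y → x < len q → y < len q → g x ≡ g y → x ≡ y) ×
  (∀ x y → x < y → y < len q → col q x y ≡ symcol p (g x) (g y))

_⊎P_ : Pattern → Pattern → Pattern
p ⊎P q = pat (len p + len q ∸ 1) c
  where
  c : ℕ → ℕ → Bool
  c x y = if does (y <? len p) then col p x y
          else if does (x <? len p ∸ 1) then col p x (len p ∸ 1)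
          else col q (x ∸ (len p ∸ 1)) (y ∸ (len p ∸ 1))

Reducible : Pattern → Set
Reducible r = ∃ λ p → ∃ λ q → 2 ≤ len p × 2 ≤ len q × r ≈P (p ⊎P q)

Convergent : Pattern → Set
Convergent p = ∀ x x' → x < len p ∸ 1 → x' < len p ∸ 1 →
  col p x (len p ∸ 1) ≡ col p x' (len p ∸ 1)

-- i-merging. A partition F ⊔ G of {0,…,ℓ-2} is given by F's characteristic
-- function on {0,…,ℓ-2}; G is its complement there.
Merging : Bool → Pattern → Set
Merging i p = ∀ (F : ℕ → Bool) →
  let ℓ-1 = len p ∸ 1
      inF = λ x → x < ℓ-1 × F x ≡ true
      inG = λ x → x < ℓ-1 × F x ≡ false
  in (∃ λ x → inF x) → (∃ λ y → inG y) → (∀ x y → inF x → inG y → x < y) →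
     (∃ λ x → inF x × col p x ℓ-1 ≡ not i) ⊎
     (∃ λ x → inG x × col p x ℓ-1 ≡ i) ⊎
     (∃ λ x₀ → ∃ λ x₁ → ∃ λ y₀ → ∃ λ y₁ →
        inF x₀ × inF x₁ × inG y₀ × inG y₁ × col p x₀ y₀ ≢ col p x₁ y₁)

StronglyAppears : Pattern → Coloring → (ℕ → Bool) → Set
StronglyAppears p f H = Σ (ℕ → ℕ) λ x →
  let ℓ-1 = len p ∸ 1 in
  (∀ a → a < ℓ-1 → H (x a) ≡ true) ×
  (∀ a b → a < b → b < ℓ-1 → x a < x b) ×
  (∀ a b → a < b → b < ℓ-1 → f (x a) (x b) ≡ col p a b) ×
  (∀ a → a < ℓ-1 → Cofinitely (λ y → f (x a) y ≡ col p a ℓ-1))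

{-# OPTIONS --safe #-}
-- Induction on the length of the pattern q: above every bound we find points of H that strongly
-- f-realize q. Let m be the index of the last point of q.
--
-- If q is reducible, or is not i-merging with crossing colour i, it has a cut 0 < j < m such that every
-- crossing colour col q a c (a < j ≤ c) equals the limit colour col q a m. Strongly realize the part
-- before the cut (plus the last point), then strongly realize the part after the cut beyond all
-- stabilisation points of the first part; the two together strongly realize q.
--
-- Otherwise q is convergent or is not i-merging with crossing colour 1 - i: for some j ≤ m the points
-- before j must lie in A_i(f), the points from j on in A_{1-i}(f), and all crossing colours are 1 - i.
-- By induction both parts are realizable in H above every bound, and the least canonical index of
-- such a realization is found by an H-computable μ-search. This yields an H-computable bi-array; by
-- 2-dimensional H-hyperimmunity it meets 𝓗_i(f), and the meeting pair glued together realizes q with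
-- limit colours i and 1 - i, as required.
module Submission where

open import Defs
open import Data.Nat using (ℕ; _≤_; _≥_)
open import Data.Bool using (Bool)
open import Data.Sum using (_⊎_)
open import Relation.Nullary using (¬_)

open import Data.Bool using (true; false; not)
open import Data.Bool.Properties using () renaming (_≟_ to _≟ᵇ_)
open import Data.Empty using (⊥-elim)
open import Data.Fin using (Fin; #_) renaming (zero to fzero; suc to fsuc)
open import Data.Nat using (zero; suc; pred; _+_; _*_; _∸_; _^_; _⊔_; _<_; _/_; _%_; _≡ᵇ_; _<ᵇ_; ∣_-_∣; _≟_; _<?_; _≤?_; z≤n; s≤s; s≤s⁻¹)
open import Data.Nat.DivMod using (m/n≡1+[m∸n]/n; [m+kn]%n≡m%n; +-distrib-/; m*n%n≡0; m%n<n; m*n/n≡m; m/n<m)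
open import Data.Nat.GeneralisedArithmetic using (iterate; iterate-is-fold)
open import Data.Nat.Properties
open import Algebra.Properties.CommutativeSemigroup +-commutativeSemigroup using (xy∙z≈xz∙y)
open import Data.Product using (Σ; ∃; _×_; _,_; proj₁; proj₂)
open import Data.Sum using (inj₁; inj₂; [_,_]′)
open import Data.Unit using (tt)
open import Data.Vec using (Vec; []; _∷_; lookup; tabulate)
open import Data.Vec.Properties using (tabulate∘lookup)
open import Function using (_∘_)
open import Relation.Binary.Definitions using (tri<; tri≈; tri>)
open import Relation.Binary.PropositionalEquality
open import Relation.Nullary using (yes; no)

-- Relative computability

Fn : ℕ → Set
Fn n = Vec ℕ n → ℕ

Computable : (ℕ → Bool) → (n : ℕ) → Fn n → Set
Computable O n F = Σ (Code n) λ c → ∀ xs → Eval O c xs (F xs)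

ComputableVec : (ℕ → Bool) → (n k : ℕ) → (Vec ℕ n → Vec ℕ k) → Set
ComputableVec O n k Fs = Σ (Vec (Code n) k) λ cs → ∀ xs → EvalV O cs xs (Fs xs)

primrec : ∀ {n} → Fn n → Fn (suc (suc n)) → Fn (suc n)
primrec G S (zero  ∷ xs) = G xs
primrec G S (suc k ∷ xs) = S (k ∷ primrec G S (k ∷ xs) ∷ xs)

module _ {O : ℕ → Bool} where

  computable-cong : ∀ {n} {F G : Fn n} → (∀ xs → F xs ≡ G xs) → Computable O n F → Computable O n G
  computable-cong F≗G (c , ok) = c , λ xs → subst (Eval O c xs) (F≗G xs) (ok xs)

  computable-zero : ∀ {n} → Computable O n (λ _ → 0)
  computable-zero = zer , λ _ → e-zer

  computable-suc : Computable O 1 (λ xs → suc (lookup xs fzero))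
  computable-suc = succ , λ { (x ∷ []) → e-succ }

  computable-oracle : Computable O 1 (λ xs → bool→ℕ (O (lookup xs fzero)))
  computable-oracle = orc , λ { (x ∷ []) → e-orc }

  argᶜ : ∀ {n} (i : Fin n) → Computable O n (λ xs → lookup xs i)
  argᶜ i = proj i , λ _ → e-proj

  []ᶜ : ∀ {n} → ComputableVec O n 0 (λ _ → [])
  []ᶜ = [] , λ _ → ev-[]

  infixr 5 _∷ᶜ_
  _∷ᶜ_ : ∀ {n k} {F : Fn n} {Fs : Vec ℕ n → Vec ℕ k} →
         Computable O n F → ComputableVec O n k Fs → ComputableVec O n (suc k) (λ xs → F xs ∷ Fs xs)
  (c , ok) ∷ᶜ (cs , oks) = c ∷ cs , λ xs → ev-∷ (ok xs) (oks xs)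

  projectionsᶜ : ∀ {n k} (π : Fin k → Fin n) → ComputableVec O n k (λ xs → tabulate (λ i → lookup xs (π i)))
  projectionsᶜ {k = zero}  π = []ᶜ
  projectionsᶜ {k = suc k} π = argᶜ (π fzero) ∷ᶜ projectionsᶜ (π ∘ fsuc)

  computable-∘ : ∀ {n k} {G : Fn k} {Fs : Vec ℕ n → Vec ℕ k} →
                 Computable O k G → ComputableVec O n k Fs → Computable O n (λ xs → G (Fs xs))
  computable-∘ (c , ok) (cs , oks) = comp c cs , λ xs → e-comp (oks xs) (ok _)

  compose₁ : ∀ {n} {G : Fn 1} {F : Fn n} → Computable O 1 G → Computable O n F →
             Computable O n (λ xs → G (F xs ∷ []))
  compose₁ cG cF = computable-∘ cG (cF ∷ᶜ []ᶜ)

  compose₂ : ∀ {n} {G : Fn 2} {F₁ F₂ : Fn n} → Computable O 2 G → Computable O n F₁ → Computable O n F₂ →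
             Computable O n (λ xs → G (F₁ xs ∷ F₂ xs ∷ []))
  compose₂ cG cF₁ cF₂ = computable-∘ cG (cF₁ ∷ᶜ cF₂ ∷ᶜ []ᶜ)

  compose₃ : ∀ {n} {G : Fn 3} {F₁ F₂ F₃ : Fn n} → Computable O 3 G →
             Computable O n F₁ → Computable O n F₂ → Computable O n F₃ →
             Computable O n (λ xs → G (F₁ xs ∷ F₂ xs ∷ F₃ xs ∷ []))
  compose₃ cG cF₁ cF₂ cF₃ = computable-∘ cG (cF₁ ∷ᶜ cF₂ ∷ᶜ cF₃ ∷ᶜ []ᶜ)

  computable-primrec : ∀ {n} {G : Fn n} {S : Fn (suc (suc n))} →
                       Computable O n G → Computable O (suc (suc n)) S → Computable O (suc n) (primrec G S)
  computable-primrec {G = G} {S} (g , okG) (s , okS) = prec g s , run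
    where
    run : ∀ xs → Eval O (prec g s) xs (primrec G S xs)
    run (zero  ∷ xs) = e-prec0 (okG xs)
    run (suc k ∷ xs) = e-precS (run (k ∷ xs)) (okS _)

  computable-by-recursion : ∀ {n} {F : Fn (suc n)} {G : Fn n} {S : Fn (suc (suc n))} →
    Computable O n G → Computable O (suc (suc n)) S →
    (∀ xs → F (0 ∷ xs) ≡ G xs) → (∀ k xs → F (suc k ∷ xs) ≡ S (k ∷ F (k ∷ xs) ∷ xs)) →
    Computable O (suc n) F
  computable-by-recursion {F = F} {G} {S} cG cS base step = computable-cong agree (computable-primrec cG cS)
    where
    agree : ∀ xs → primrec G S xs ≡ F xs
    agree (zero  ∷ xs) = sym (base xs)
    agree (suc k ∷ xs) = trans (cong (λ v → S (k ∷ v ∷ xs)) (agree (k ∷ xs))) (sym (step k xs))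

  computable-μ : ∀ {n} {P : Fn (suc n)} → Computable O (suc n) P → (F : Fn n) →
                 (∀ xs → P (F xs ∷ xs) ≡ 0) → (∀ xs j → j < F xs → P (j ∷ xs) ≢ 0) → Computable O n F
  computable-μ (c , ok) F zero-at below = mu c , λ xs →
    e-mu (subst (Eval O c _) (zero-at xs) (ok _)) (λ j j< → positive (ok (j ∷ xs)) (below xs j j<))
    where
    positive : ∀ {xs m} → Eval O c xs m → m ≢ 0 → ∃ λ v → Eval O c xs (suc v)
    positive {m = zero}  _ m≢0 = ⊥-elim (m≢0 refl)
    positive {m = suc v} e _   = v , e

  computable₁ : ∀ {F : Fn 1} → Computable O 1 F → Computable₁ O (λ x → F (x ∷ []))
  computable₁ (c , ok) = c , λ x → ok (x ∷ [])

  computable₂ : ∀ {F : Fn 2} → Computable O 2 F → Computable₂ O (λ x y → F (x ∷ y ∷ []))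
  computable₂ (c , ok) = c , λ x y → ok (x ∷ y ∷ [])

  constᶜ : ∀ {n} (k : ℕ) → Computable O n (λ _ → k)
  constᶜ zero    = computable-zero
  constᶜ (suc k) = compose₁ computable-suc (constᶜ k)

  sucᶜ : ∀ {n} {F : Fn n} → Computable O n F → Computable O n (λ xs → suc (F xs))
  sucᶜ = compose₁ computable-suc

  private
    plus : Computable O 2 (λ { (x ∷ y ∷ []) → x + y })
    plus = computable-by-recursion (argᶜ (# 0)) (sucᶜ (argᶜ (# 1)))
      (λ { (y ∷ []) → refl }) (λ { k (y ∷ []) → refl })

    times : Computable O 2 (λ { (x ∷ y ∷ []) → x * y })
    times = computable-by-recursion computable-zero (compose₂ plus (argᶜ (# 2)) (argᶜ (# 1)))
      (λ { (y ∷ []) → refl }) (λ { k (y ∷ []) → refl })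

    predecessor : Computable O 1 (λ { (x ∷ []) → pred x })
    predecessor = computable-by-recursion computable-zero (argᶜ (# 0)) (λ { [] → refl }) (λ { k [] → refl })

    monus : Computable O 2 (λ { (y ∷ x ∷ []) → x ∸ y })
    monus = computable-by-recursion (argᶜ (# 0)) (compose₁ predecessor (argᶜ (# 1)))
      (λ { (x ∷ []) → refl }) (λ { k (x ∷ []) → sym (pred[m∸n]≡m∸[1+n] x k) })

  infixl 6 _+ᶜ_ _∸ᶜ_
  infixl 7 _*ᶜ_

  _+ᶜ_ : ∀ {n} {F₁ F₂ : Fn n} → Computable O n F₁ → Computable O n F₂ → Computable O n (λ xs → F₁ xs + F₂ xs)
  _+ᶜ_ = compose₂ plus

  _*ᶜ_ : ∀ {n} {F₁ F₂ : Fn n} → Computable O n F₁ → Computable O n F₂ → Computable O n (λ xs → F₁ xs * F₂ xs)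
  _*ᶜ_ = compose₂ times

  _∸ᶜ_ : ∀ {n} {F₁ F₂ : Fn n} → Computable O n F₁ → Computable O n F₂ → Computable O n (λ xs → F₁ xs ∸ F₂ xs)
  cF₁ ∸ᶜ cF₂ = compose₂ monus cF₂ cF₁

mutual
  relativise : ∀ {n} → Code n → Code n
  relativise zer         = zer
  relativise succ        = succ
  relativise (proj i)    = proj i
  relativise (comp c cs) = comp (relativise c) (relativiseV cs)
  relativise (prec g s)  = prec (relativise g) (relativise s)
  relativise (mu c)      = mu (relativise c)
  relativise orc         = zer

  relativiseV : ∀ {n k} → Vec (Code n) k → Vec (Code n) k
  relativiseV []       = []
  relativiseV (c ∷ cs) = relativise c ∷ relativiseV cs

mutual
  relativise-eval : ∀ {O n} {c : Code n} {xs v} → Eval emptyOracle c xs v → Eval O (relativise c) xs v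
  relativise-eval e-zer          = e-zer
  relativise-eval e-succ         = e-succ
  relativise-eval e-proj         = e-proj
  relativise-eval (e-comp es e)  = e-comp (relativise-evalV es) (relativise-eval e)
  relativise-eval (e-prec0 e)    = e-prec0 (relativise-eval e)
  relativise-eval (e-precS e e′) = e-precS (relativise-eval e) (relativise-eval e′)
  relativise-eval (e-mu e below) = e-mu (relativise-eval e) (λ j j< → proj₁ (below j j<) , relativise-eval (proj₂ (below j j<)))
  relativise-eval e-orc          = e-zer

  relativise-evalV : ∀ {O n k} {cs : Vec (Code n) k} {xs ys} → EvalV emptyOracle cs xs ys → EvalV O (relativiseV cs) xs ys
  relativise-evalV ev-[]       = ev-[]
  relativise-evalV (ev-∷ e es) = ev-∷ (relativise-eval e) (relativise-evalV es)

first-or-all : ∀ {P Q : ℕ → Set} → (∀ x → P x ⊎ Q x) → ∀ n →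
               (∃ λ x → x < n × P x × ∀ y → y < x → Q y) ⊎ (∀ x → x < n → Q x)
first-or-all P⊎Q zero = inj₂ (λ _ ())
first-or-all P⊎Q (suc n) with first-or-all P⊎Q n
... | inj₁ (x , x<n , Px , before) = inj₁ (x , m<n⇒m<1+n x<n , Px , before)
... | inj₂ all with P⊎Q n
...   | inj₁ Pn = inj₁ (n , n<1+n n , Pn , all)
...   | inj₂ Qn = inj₂ λ x x<1+n → [ all x , (λ { refl → Qn }) ]′ (m≤n⇒m<n∨m≡n (s≤s⁻¹ x<1+n))

least-zero : (P : ℕ → ℕ) → ∀ {w} → P w ≡ 0 → ∃ λ k → P k ≡ 0 × ∀ j → j < k → P j ≢ 0
least-zero P {w} Pw≡0 with first-or-all (λ x → zero-or-not (P x)) (suc w)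
  where
  zero-or-not : ∀ n → n ≡ 0 ⊎ n ≢ 0
  zero-or-not zero    = inj₁ refl
  zero-or-not (suc n) = inj₂ (λ ())
... | inj₁ (k , _ , Pk≡0 , before) = k , Pk≡0 , before
... | inj₂ none = ⊥-elim (none w (n<1+n w) Pw≡0)

∑< : ℕ → (ℕ → ℕ) → ℕ
∑< zero    g = 0
∑< (suc t) g = ∑< t g + g t

∣m-n∣≡[m∸n]+[n∸m] : ∀ m n → ∣ m - n ∣ ≡ (m ∸ n) + (n ∸ m)
∣m-n∣≡[m∸n]+[n∸m] zero    n       = cong (_+ n) (sym (0∸n≡0 n))
∣m-n∣≡[m∸n]+[n∸m] (suc m) zero    = sym (+-identityʳ (suc m))
∣m-n∣≡[m∸n]+[n∸m] (suc m) (suc n) = ∣m-n∣≡[m∸n]+[n∸m] m n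

module _ {O : ℕ → Bool} where

  ∑<ᶜ : ∀ {n} {G : Fn (suc n)} → Computable O (suc n) G →
        Computable O (suc n) (λ { (t ∷ xs) → ∑< t (λ z → G (z ∷ xs)) })
  ∑<ᶜ {G = G} cG = computable-by-recursion computable-zero
    (argᶜ (# 1) +ᶜ computable-∘ cG (argᶜ (# 0) ∷ᶜ projectionsᶜ (fsuc ∘ fsuc)))
    (λ _ → refl) (λ k xs → cong (λ ys → ∑< k (λ z → G (z ∷ xs)) + G (k ∷ ys)) (sym (tabulate∘lookup xs)))

  ∣_-_∣ᶜ : ∀ {n} {F₁ F₂ : Fn n} → Computable O n F₁ → Computable O n F₂ →
           Computable O n (λ xs → ∣ F₁ xs - F₂ xs ∣)
  ∣_-_∣ᶜ {F₁ = F₁} {F₂} cF₁ cF₂ =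
    computable-cong (λ xs → sym (∣m-n∣≡[m∸n]+[n∸m] (F₁ xs) (F₂ xs))) ((cF₁ ∸ᶜ cF₂) +ᶜ (cF₂ ∸ᶜ cF₁))

  computable-least-zero : ∀ {n} {P : Fn (suc n)} → Computable O (suc n) P → (∀ xs → ∃ λ w → P (w ∷ xs) ≡ 0) →
                          Σ (Fn n) λ F → Computable O n F × ∀ xs → P (F xs ∷ xs) ≡ 0
  computable-least-zero {n} {P} cP zeros =
    F , computable-μ cP F (λ xs → proj₁ (proj₂ (least xs))) (λ xs → proj₂ (proj₂ (least xs))) ,
    λ xs → proj₁ (proj₂ (least xs))
    where
    least : ∀ xs → ∃ λ k → P (k ∷ xs) ≡ 0 × ∀ j → j < k → P (j ∷ xs) ≢ 0
    least xs = least-zero (λ w → P (w ∷ xs)) (proj₂ (zeros xs))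
    F : Fn n
    F xs = proj₁ (least xs)

-- Binary digits and canonical indices of finite sets

1+n%2≡1∸n%2 : ∀ n → suc n % 2 ≡ 1 ∸ n % 2
1+n%2≡1∸n%2 zero          = refl
1+n%2≡1∸n%2 (suc zero)    = refl
1+n%2≡1∸n%2 (suc (suc n)) = 1+n%2≡1∸n%2 n

1+n/2≡n/2+n%2 : ∀ n → suc n / 2 ≡ n / 2 + n % 2
1+n/2≡n/2+n%2 zero          = refl
1+n/2≡n/2+n%2 (suc zero)    = refl
1+n/2≡n/2+n%2 (suc (suc n)) = begin
  suc (suc (suc n)) / 2             ≡⟨ m/n≡1+[m∸n]/n {suc (suc (suc n))} {2} (s≤s (s≤s z≤n)) ⟩
  suc (suc n / 2)                   ≡⟨ cong suc (1+n/2≡n/2+n%2 n) ⟩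
  suc (n / 2 + n % 2)               ≡⟨ cong (_+ n % 2) (m/n≡1+[m∸n]/n {suc (suc n)} {2} (s≤s (s≤s z≤n))) ⟨
  suc (suc n) / 2 + suc (suc n) % 2 ∎
  where open ≡-Reasoning

m%2≡0⇒[m+1]%2≡1 : ∀ m → m % 2 ≡ 0 → (m + 1) % 2 ≡ 1
m%2≡0⇒[m+1]%2≡1 m m%2≡0 = trans (cong (_% 2) (+-comm m 1)) (trans (1+n%2≡1∸n%2 m) (cong (1 ∸_) m%2≡0))

m%2≡0⇒[m+1]/2≡m/2 : ∀ m → m % 2 ≡ 0 → (m + 1) / 2 ≡ m / 2
m%2≡0⇒[m+1]/2≡m/2 m m%2≡0 =
  trans (cong (_/ 2) (+-comm m 1)) (trans (1+n/2≡n/2+n%2 m) (trans (cong (m / 2 +_) m%2≡0) (+-identityʳ (m / 2))))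

[m+2^[1+x]]%2≡m%2 : ∀ m x → (m + 2 ^ suc x) % 2 ≡ m % 2
[m+2^[1+x]]%2≡m%2 m x = trans (cong (λ v → (m + v) % 2) (*-comm 2 (2 ^ x))) ([m+kn]%n≡m%n m (2 ^ x) 2)

[m+2^[1+x]]/2≡m/2+2^x : ∀ m x → (m + 2 ^ suc x) / 2 ≡ m / 2 + 2 ^ x
[m+2^[1+x]]/2≡m/2+2^x m x = begin
  (m + 2 ^ suc x) / 2          ≡⟨ cong (λ v → (m + v) / 2) (*-comm 2 (2 ^ x)) ⟩
  (m + 2 ^ x * 2) / 2          ≡⟨ +-distrib-/ m (2 ^ x * 2) no-carry ⟩
  m / 2 + 2 ^ x * 2 / 2        ≡⟨ cong (m / 2 +_) (m*n/n≡m (2 ^ x) 2) ⟩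
  m / 2 + 2 ^ x                ∎
  where
  open ≡-Reasoning
  no-carry : m % 2 + 2 ^ x * 2 % 2 < 2
  no-carry = subst (λ r → m % 2 + r < 2) (sym (m*n%n≡0 (2 ^ x) 2))
                   (subst (_< 2) (sym (+-identityʳ (m % 2))) (m%n<n m 2))

-- Iterating the halving, rather than recursing on s / 2, keeps bitℕ primitive recursive
-- while bitℕ s (suc x) still reduces to bitℕ (s / 2) x, exactly as bit does.
bitℕ : ℕ → ℕ → ℕ
bitℕ s x = iterate (_/ 2) s x % 2

bit≡bitℕ≡ᵇ1 : ∀ s x → bit s x ≡ (bitℕ s x ≡ᵇ 1)
bit≡bitℕ≡ᵇ1 s zero    = refl
bit≡bitℕ≡ᵇ1 s (suc x) = bit≡bitℕ≡ᵇ1 (s / 2) x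

bitℕ≡0⊎bitℕ≡1 : ∀ s x → bitℕ s x ≡ 0 ⊎ bitℕ s x ≡ 1
bitℕ≡0⊎bitℕ≡1 s x with bitℕ s x | m%n<n (iterate (_/ 2) s x) 2
... | zero        | _ = inj₁ refl
... | suc zero    | _ = inj₂ refl
... | suc (suc _) | s≤s (s≤s ())

∈D⇒bitℕ≡1 : ∀ {x s} → x ∈D s → bitℕ s x ≡ 1
∈D⇒bitℕ≡1 {x} {s} x∈s with bitℕ≡0⊎bitℕ≡1 s x
... | inj₂ b≡1 = b≡1
... | inj₁ b≡0 with () ← trans (sym x∈s) (trans (bit≡bitℕ≡ᵇ1 s x) (cong (_≡ᵇ 1) b≡0))

bitℕ≡1⇒∈D : ∀ {x s} → bitℕ s x ≡ 1 → x ∈D s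
bitℕ≡1⇒∈D {x} {s} b≡1 = trans (bit≡bitℕ≡ᵇ1 s x) (cong (_≡ᵇ 1) b≡1)

bitℕ-zero : ∀ x → bitℕ 0 x ≡ 0
bitℕ-zero zero    = refl
bitℕ-zero (suc x) = bitℕ-zero x

bitℕ≡1⇒< : ∀ {s} x → bitℕ s x ≡ 1 → x < s
bitℕ≡1⇒< {zero}  x       b≡1 with () ← trans (sym (bitℕ-zero x)) b≡1
bitℕ≡1⇒< {suc s} zero    _   = s≤s z≤n
bitℕ≡1⇒< {suc s} (suc x) b≡1 = <-≤-trans (s≤s (bitℕ≡1⇒< x b≡1)) (m/n<m (suc s) 2 (s≤s (s≤s z≤n)))

bitℕ-insert-same : ∀ x s → bitℕ s x ≡ 0 → bitℕ (s + 2 ^ x) x ≡ 1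
bitℕ-insert-same zero    s b≡0 = m%2≡0⇒[m+1]%2≡1 s b≡0
bitℕ-insert-same (suc x) s b≡0 =
  trans (cong (λ v → bitℕ v x) ([m+2^[1+x]]/2≡m/2+2^x s x)) (bitℕ-insert-same x (s / 2) b≡0)

bitℕ-insert-other : ∀ x s w → bitℕ s x ≡ 0 → w ≢ x → bitℕ (s + 2 ^ x) w ≡ bitℕ s w
bitℕ-insert-other zero    s zero    _   w≢x = ⊥-elim (w≢x refl)
bitℕ-insert-other zero    s (suc w) b≡0 _   = cong (λ v → bitℕ v w) (m%2≡0⇒[m+1]/2≡m/2 s b≡0)
bitℕ-insert-other (suc x) s zero    _   _   = [m+2^[1+x]]%2≡m%2 s x
bitℕ-insert-other (suc x) s (suc w) b≡0 w≢x =
  trans (cong (λ v → bitℕ v w) ([m+2^[1+x]]/2≡m/2+2^x s x)) (bitℕ-insert-other x (s / 2) w b≡0 (w≢x ∘ cong suc))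

iterate-suc : ∀ {A : Set} (f : A → A) x k → iterate f x (suc k) ≡ f (iterate f x k)
iterate-suc f x k = trans (sym (iterate-is-fold x f (suc k))) (cong f (iterate-is-fold x f k))

module _ {O : ℕ → Bool} where
  private
    parity : Computable O 1 (λ { (n ∷ []) → n % 2 })
    parity = computable-by-recursion computable-zero (constᶜ 1 ∸ᶜ argᶜ (# 1))
      (λ { [] → refl }) (λ { k [] → 1+n%2≡1∸n%2 k })

    halve : Computable O 1 (λ { (n ∷ []) → n / 2 })
    halve = computable-by-recursion computable-zero (argᶜ (# 1) +ᶜ compose₁ parity (argᶜ (# 0)))
      (λ { [] → refl }) (λ { k [] → 1+n/2≡n/2+n%2 k })

    halve-iterated : Computable O 2 (λ { (x ∷ s ∷ []) → iterate (_/ 2) s x })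
    halve-iterated = computable-by-recursion (argᶜ (# 0)) (compose₁ halve (argᶜ (# 1)))
      (λ { (s ∷ []) → refl }) (λ { k (s ∷ []) → iterate-suc (_/ 2) s k })

  bitℕᶜ : ∀ {n} {S X : Fn n} → Computable O n S → Computable O n X → Computable O n (λ xs → bitℕ (S xs) (X xs))
  bitℕᶜ cS cX = compose₁ parity (compose₂ halve-iterated cX cS)

∑<-mono-≤ : ∀ (g : ℕ → ℕ) {x y} → x ≤ y → ∑< x g ≤ ∑< y g
∑<-mono-≤ g {y = zero}  z≤n = ≤-refl
∑<-mono-≤ g {y = suc y} x≤1+y with m≤n⇒m<n∨m≡n x≤1+y
... | inj₁ x<1+y = ≤-trans (∑<-mono-≤ g (s≤s⁻¹ x<1+y)) (m≤m+n (∑< y g) (g y))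
... | inj₂ refl  = ≤-refl

∑<≡0⇒≡0 : ∀ (g : ℕ → ℕ) t → ∑< t g ≡ 0 → ∀ z → z < t → g z ≡ 0
∑<≡0⇒≡0 g (suc t) sum≡0 z z<1+t with m≤n⇒m<n∨m≡n (s≤s⁻¹ z<1+t)
... | inj₁ z<t  = ∑<≡0⇒≡0 g t (m+n≡0⇒m≡0 _ sum≡0) z z<t
... | inj₂ refl = m+n≡0⇒n≡0 (∑< t g) sum≡0

∑<-zeros : ∀ (g : ℕ → ℕ) t → (∀ z → z < t → g z ≡ 0) → ∑< t g ≡ 0
∑<-zeros g zero    _     = refl
∑<-zeros g (suc t) zeros = cong₂ _+_ (∑<-zeros g t (λ z → zeros z ∘ m<n⇒m<1+n)) (zeros t (n<1+n t))

∑<-ones : ∀ (g : ℕ → ℕ) t → (∀ z → z < t → g z ≡ 1) → ∑< t g ≡ t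
∑<-ones g zero    _    = refl
∑<-ones g (suc t) ones = trans (cong₂ _+_ (∑<-ones g t (λ z → ones z ∘ m<n⇒m<1+n)) (ones t (n<1+n t))) (+-comm t 1)

∑<-zeros-above : ∀ (g : ℕ → ℕ) {c t} → c ≤ t → (∀ z → c ≤ z → z < t → g z ≡ 0) → ∑< t g ≡ ∑< c g
∑<-zeros-above g {t = zero}  z≤n     _     = refl
∑<-zeros-above g {t = suc t} c≤1+t zeros with m≤n⇒m<n∨m≡n c≤1+t
... | inj₁ c<1+t = trans (cong₂ _+_ (∑<-zeros-above g (s≤s⁻¹ c<1+t) (λ z c≤z → zeros z c≤z ∘ m<n⇒m<1+n))
                                    (zeros t (s≤s⁻¹ c<1+t) (n<1+n t)))
                         (+-identityʳ _)
... | inj₂ refl  = refl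

bounded-choice : ∀ {P : ℕ → ℕ → Set} K → (∀ a → a < K → Σ ℕ (P a)) →
                 Σ (ℕ → ℕ) λ y → ∀ a → a < K → P a (y a)
bounded-choice {P} K choose = y , y-spec
  where
  y : ℕ → ℕ
  y a with a <? K
  ... | yes a<K = proj₁ (choose a a<K)
  ... | no  _   = 0
  y-spec : ∀ a → a < K → P a (y a)
  y-spec a a<K with a <? K
  ... | yes a<K′ = proj₂ (choose a a<K′)
  ... | no  a≮K  = ⊥-elim (a≮K a<K)

rank : ℕ → ℕ → ℕ
rank s x = ∑< x (bitℕ s)

rank-mono-≤ : ∀ s {x y} → x ≤ y → rank s x ≤ rank s y
rank-mono-≤ s = ∑<-mono-≤ (bitℕ s)

rank-exists : ∀ s t a → a < rank s t → ∃ λ z → z < t × bitℕ s z ≡ 1 × rank s z ≡ a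
rank-exists s (suc t) a a<rank with a <? rank s t | bitℕ≡0⊎bitℕ≡1 s t
... | yes a<rank′ | _ =
  let (z , z<t , bit≡1 , rank≡a) = rank-exists s t a a<rank′ in z , m<n⇒m<1+n z<t , bit≡1 , rank≡a
... | no  a≮rank′ | inj₁ b≡0 =
  ⊥-elim (a≮rank′ (subst (a <_) (trans (cong (rank s t +_) b≡0) (+-identityʳ _)) a<rank))
... | no  a≮rank′ | inj₂ b≡1 =
  t , n<1+n t , b≡1 ,
  ≤-antisym (≮⇒≥ a≮rank′) (s≤s⁻¹ (subst (a <_) (trans (cong (rank s t +_) b≡1) (+-comm _ 1)) a<rank))

rank-enumeration : ∀ s {K} → rank s s ≡ K →
                   Σ (ℕ → ℕ) λ y → ∀ a → a < K → bitℕ s (y a) ≡ 1 × rank s (y a) ≡ a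
rank-enumeration s {K} size = bounded-choice {λ a z → bitℕ s z ≡ 1 × rank s z ≡ a} K λ a a<K →
  let (z , _ , bz , rz) = rank-exists s s a (subst (a <_) (sym size) a<K) in z , bz , rz

rank-cancel-< : ∀ s {x y} → rank s x < rank s y → x < y
rank-cancel-< s {x} {y} rank< with x <? y
... | yes x<y = x<y
... | no  x≮y = ⊥-elim (<⇒≱ rank< (rank-mono-≤ s (≮⇒≥ x≮y)))

rank-strict : ∀ s {x y} → bitℕ s x ≡ 1 → x < y → rank s x < rank s y
rank-strict s {x} b≡1 x<y = ≤-trans (≤-reflexive (trans (+-comm 1 (rank s x)) (cong (rank s x +_) (sym b≡1))))
                                    (rank-mono-≤ s x<y)

𝟙[_<_] : ℕ → ℕ → ℕ
𝟙[ x     < zero  ] = 0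
𝟙[ zero  < suc z ] = 1
𝟙[ suc x < suc z ] = 𝟙[ x < z ]

𝟙[<]-yes : ∀ {x z} → x < z → 𝟙[ x < z ] ≡ 1
𝟙[<]-yes {zero}  {suc z} _       = refl
𝟙[<]-yes {suc x} {suc z} 1+x<1+z = 𝟙[<]-yes (s≤s⁻¹ 1+x<1+z)

𝟙[<]-no : ∀ {x z} → z ≤ x → 𝟙[ x < z ] ≡ 0
𝟙[<]-no {x}     {zero}  _       = refl
𝟙[<]-no {suc x} {suc z} 1+z≤1+x = 𝟙[<]-no (s≤s⁻¹ 1+z≤1+x)

𝟙[<]-suc : ∀ {x z} → z ≢ x → 𝟙[ x < suc z ] ≡ 𝟙[ x < z ]
𝟙[<]-suc {zero}  {zero}  z≢x = ⊥-elim (z≢x refl)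
𝟙[<]-suc {zero}  {suc z} _   = refl
𝟙[<]-suc {suc x} {zero}  _   = refl
𝟙[<]-suc {suc x} {suc z} z≢x = 𝟙[<]-suc (z≢x ∘ cong suc)

rank-insert : ∀ s x → bitℕ s x ≡ 0 → ∀ z → rank (s + 2 ^ x) z ≡ rank s z + 𝟙[ x < z ]
rank-insert s x b≡0 zero = refl
rank-insert s x b≡0 (suc z) with z ≟ x
... | yes refl = begin
  rank (s + 2 ^ z) z + bitℕ (s + 2 ^ z) z  ≡⟨ cong₂ _+_ (rank-insert s z b≡0 z) (bitℕ-insert-same z s b≡0) ⟩
  rank s z + 𝟙[ z < z ] + 1                 ≡⟨ cong (λ u → rank s z + u + 1) (trans (𝟙[<]-no {z} ≤-refl) (sym b≡0)) ⟩
  rank s z + bitℕ s z + 1                   ≡⟨ cong (rank s (suc z) +_) (𝟙[<]-yes (n<1+n z)) ⟨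
  rank s (suc z) + 𝟙[ z < suc z ]           ∎
  where open ≡-Reasoning
... | no  z≢x  = begin
  rank (s + 2 ^ x) z + bitℕ (s + 2 ^ x) z  ≡⟨ cong₂ _+_ (rank-insert s x b≡0 z) (bitℕ-insert-other x s z b≡0 z≢x) ⟩
  rank s z + 𝟙[ x < z ] + bitℕ s z         ≡⟨ xy∙z≈xz∙y (rank s z) 𝟙[ x < z ] (bitℕ s z) ⟩
  rank s (suc z) + 𝟙[ x < z ]               ≡⟨ cong (rank s (suc z) +_) (𝟙[<]-suc z≢x) ⟨
  rank s (suc z) + 𝟙[ x < suc z ]           ∎
  where open ≡-Reasoning

code : ℕ → (ℕ → ℕ) → ℕ
code j y = ∑< j (λ a → 2 ^ y a)

module IncreasingCode (K : ℕ) (y : ℕ → ℕ) (increasing : ∀ a c → a < c → c < K → y a < y c) where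

  mutual
    code-members : ∀ j → j ≤ K → ∀ w → bitℕ (code j y) w ≡ 1 → ∃ λ a → a < j × y a ≡ w
    code-members zero    _   w b≡1 with () ← trans (sym (bitℕ-zero w)) b≡1
    code-members (suc j) j<K w b≡1 with w ≟ y j
    ... | yes refl = j , n<1+n j , refl
    ... | no  w≢yj =
      let same-bit = bitℕ-insert-other (y j) (code j y) w (code-fresh j j<K) w≢yj
          (a , a<j , ya≡w) = code-members j (<⇒≤ j<K) w (trans (sym same-bit) b≡1)
      in a , m<n⇒m<1+n a<j , ya≡w

    code-fresh : ∀ j → j < K → bitℕ (code j y) (y j) ≡ 0
    code-fresh j j<K with bitℕ≡0⊎bitℕ≡1 (code j y) (y j)
    ... | inj₁ b≡0 = b≡0
    ... | inj₂ b≡1 = let (a , a<j , ya≡yj) = code-members j (<⇒≤ j<K) (y j) b≡1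
                     in ⊥-elim (<-irrefl ya≡yj (increasing a j a<j j<K))

  code-contains : ∀ j → j ≤ K → ∀ a → a < j → bitℕ (code j y) (y a) ≡ 1
  code-contains (suc j) j<K a a<1+j with a ≟ j
  ... | yes refl = bitℕ-insert-same (y a) (code a y) (code-fresh a j<K)
  ... | no  a≢j  = trans (bitℕ-insert-other (y j) (code j y) (y a) (code-fresh j j<K) (<⇒≢ (increasing a j a<j j<K)))
                         (code-contains j (<⇒≤ j<K) a a<j)
    where
    a<j : a < j
    a<j = ≤∧≢⇒< (s≤s⁻¹ a<1+j) a≢j

  rank-code : ∀ j → j ≤ K → ∀ z → rank (code j y) z ≡ ∑< j (λ a → 𝟙[ y a < z ])
  rank-code zero    _   z = ∑<-zeros (bitℕ 0) z (λ w _ → bitℕ-zero w)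
  rank-code (suc j) j<K z = trans (rank-insert (code j y) (y j) (code-fresh j j<K) z)
                                  (cong (_+ 𝟙[ y j < z ]) (rank-code j (<⇒≤ j<K) z))

  rank-code-at : ∀ c → c < K → rank (code K y) (y c) ≡ c
  rank-code-at c c<K = begin
    rank (code K y) (y c)          ≡⟨ rank-code K ≤-refl (y c) ⟩
    ∑< K (λ a → 𝟙[ y a < y c ])    ≡⟨ ∑<-zeros-above _ (<⇒≤ c<K) (λ a c≤a a<K → 𝟙[<]-no (y-mono c≤a a<K)) ⟩
    ∑< c (λ a → 𝟙[ y a < y c ])    ≡⟨ ∑<-ones _ c (λ a a<c → 𝟙[<]-yes (increasing a c a<c c<K)) ⟩
    c                              ∎
    where
    open ≡-Reasoning
    y-mono : ∀ {a} → c ≤ a → a < K → y c ≤ y a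
    y-mono c≤a a<K with m≤n⇒m<n∨m≡n c≤a
    ... | inj₁ c<a  = <⇒≤ (increasing c _ c<a a<K)
    ... | inj₂ refl = ≤-refl

  rank-code-total : rank (code K y) (code K y) ≡ K
  rank-code-total = trans (rank-code K ≤-refl (code K y))
    (∑<-ones _ K (λ a a<K → 𝟙[<]-yes (bitℕ≡1⇒< (y a) (code-contains K ≤-refl a a<K))))

-- Realizations

record RealizesAbove (f : Coloring) (H : ℕ → Bool) (K : ℕ) (t : ℕ → ℕ → Bool) (b : ℕ) (y : ℕ → ℕ) : Set where
  field
    inH        : ∀ a → a < K → H (y a) ≡ true
    above      : ∀ a → a < K → b < y a
    increasing : ∀ a c → a < c → c < K → y a < y c
    colours    : ∀ a c → a < c → c < K → f (y a) (y c) ≡ t a c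

record CodesRealization (f : Coloring) (H : ℕ → Bool) (K : ℕ) (t : ℕ → ℕ → Bool) (b s : ℕ) : Set where
  field
    points        : ℕ → ℕ
    realizes      : RealizesAbove f H K t b points
    points∈       : ∀ a → a < K → points a ∈D s
    members-above : ∀ x → x ∈D s → b < x

module _ {f : Coloring} {H : ℕ → Bool} where

  realizes-cong : ∀ {K t t′ b y} → (∀ a c → a < c → c < K → t a c ≡ t′ a c) →
                  RealizesAbove f H K t b y → RealizesAbove f H K t′ b y
  realizes-cong t≗t′ R = record
    { inH = inH ; above = above ; increasing = increasing
    ; colours = λ a c a<c c<K → trans (colours a c a<c c<K) (t≗t′ a c a<c c<K) }
    where open RealizesAbove R

  realizes-≤ : ∀ {K K′ t b y} → K′ ≤ K → RealizesAbove f H K t b y → RealizesAbove f H K′ t b y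
  realizes-≤ K′≤K R = record
    { inH        = λ a a<K′ → inH a (<-≤-trans a<K′ K′≤K)
    ; above      = λ a a<K′ → above a (<-≤-trans a<K′ K′≤K)
    ; increasing = λ a c a<c c<K′ → increasing a c a<c (<-≤-trans c<K′ K′≤K)
    ; colours    = λ a c a<c c<K′ → colours a c a<c (<-≤-trans c<K′ K′≤K)
    }
    where open RealizesAbove R

  realizes-above-≤ : ∀ {K t b b′ y} → b′ ≤ b → RealizesAbove f H K t b y → RealizesAbove f H K t b′ y
  realizes-above-≤ b′≤b R = record
    { inH = inH ; above = λ a a<K → ≤-<-trans b′≤b (above a a<K) ; increasing = increasing ; colours = colours }
    where open RealizesAbove R

  realizes-empty : ∀ {t b y} → RealizesAbove f H 0 t b y
  realizes-empty = record { inH = λ _ () ; above = λ _ () ; increasing = λ _ _ _ () ; colours = λ _ _ _ () }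

  realizes-point : ∀ {t b z} → H z ≡ true → b < z → RealizesAbove f H 1 t b (λ _ → z)
  realizes-point z∈H b<z = record
    { inH = λ _ _ → z∈H ; above = λ _ _ → b<z
    ; increasing = λ { _ _ a<c (s≤s z≤n) → ⊥-elim (n≮0 a<c) }
    ; colours    = λ { _ _ a<c (s≤s z≤n) → ⊥-elim (n≮0 a<c) } }

cofinitely-∧ : ∀ {P Q : ℕ → Set} → Cofinitely P → Cofinitely Q → Cofinitely (λ y → P y × Q y)
cofinitely-∧ (M , P-beyond) (M′ , Q-beyond) =
  M ⊔ M′ , λ y M⊔M′<y → P-beyond y (m⊔n<o⇒m<o M M′ M⊔M′<y) , Q-beyond y (m⊔n<o⇒n<o M M′ M⊔M′<y)

cofinitely-∀< : ∀ K {P : ℕ → ℕ → Set} → (∀ a → a < K → Cofinitely (P a)) →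
                Cofinitely (λ y → ∀ a → a < K → P a y)
cofinitely-∀< zero    _        = 0 , λ _ _ _ ()
cofinitely-∀< (suc K) cofinite =
  let (M , beyond) = cofinitely-∧ (cofinitely-∀< K (λ a → cofinite a ∘ m<n⇒m<1+n)) (cofinite K (n<1+n K))
  in M , λ y M<y a a<1+K → [ (λ a<K → proj₁ (beyond y M<y) a a<K) , (λ { refl → proj₂ (beyond y M<y) }) ]′
                             (m≤n⇒m<n∨m≡n (s≤s⁻¹ a<1+K))

infinite-cofinitely : ∀ {H : ℕ → Bool} {P : ℕ → Set} → Infinite H → Cofinitely P → ∃ λ z → H z ≡ true × P z
infinite-cofinitely infinite-H (M , beyond) =
  let (z , M<z , z∈H) = infinite-H (suc M) in z , z∈H , beyond z M<z

glue : ℕ → (ℕ → ℕ) → (ℕ → ℕ) → ℕ → ℕ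
glue j y₁ y₂ a with a <? j
... | yes _ = y₁ a
... | no  _ = y₂ (a ∸ j)

data Side (j : ℕ) : ℕ → Set where
  before : ∀ {a} → a < j → Side j a
  after  : ∀ c → Side j (j + c)

side : ∀ j a → Side j a
side j a with a <? j
... | yes a<j = before a<j
... | no  a≮j = subst (Side j) (m+[n∸m]≡n (≮⇒≥ a≮j)) (after (a ∸ j))

module _ {j : ℕ} {y₁ y₂ : ℕ → ℕ} where

  glue-before : ∀ {a} → a < j → glue j y₁ y₂ a ≡ y₁ a
  glue-before {a} a<j with a <? j
  ... | yes _   = refl
  ... | no  a≮j = ⊥-elim (a≮j a<j)

  glue-after : ∀ c → glue j y₁ y₂ (j + c) ≡ y₂ c
  glue-after c with j + c <? j
  ... | yes j+c<j = ⊥-elim (<⇒≱ j+c<j (m≤m+n j c))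
  ... | no  _     = cong y₂ (m+n∸m≡n j c)

  glue-elim : ∀ {k} (P : ℕ → ℕ → Set) → (∀ a → a < j → P a (y₁ a)) → (∀ c → c < k → P (j + c) (y₂ c)) →
              ∀ a → a < j + k → P a (glue j y₁ y₂ a)
  glue-elim P on-before on-after a a<j+k with side j a
  ... | before a<j = subst (P a) (sym (glue-before a<j)) (on-before a a<j)
  ... | after c    = subst (P (j + c)) (sym (glue-after c)) (on-after c (+-cancelˡ-< j c _ a<j+k))

  glue-elim₂ : ∀ {k} (P : ℕ → ℕ → ℕ → ℕ → Set) →
               (∀ a c → a < c → c < j → P a c (y₁ a) (y₁ c)) →
               (∀ a c → a < j → c < k → P a (j + c) (y₁ a) (y₂ c)) →
               (∀ a c → a < c → c < k → P (j + a) (j + c) (y₂ a) (y₂ c)) →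
               ∀ a c → a < c → c < j + k → P a c (glue j y₁ y₂ a) (glue j y₁ y₂ c)
  glue-elim₂ P on-before across on-after a c a<c c<j+k with side j a | side j c
  ... | before a<j | before c<j = subst₂ (P a c) (sym (glue-before a<j)) (sym (glue-before c<j))
                                          (on-before a c a<c c<j)
  ... | before a<j | after c′   = subst₂ (P a (j + c′)) (sym (glue-before a<j)) (sym (glue-after c′))
                                          (across a c′ a<j (+-cancelˡ-< j c′ _ c<j+k))
  ... | after a′   | before c<j = ⊥-elim (<⇒≱ (<-trans a<c c<j) (m≤m+n j a′))
  ... | after a′   | after c′   = subst₂ (P (j + a′) (j + c′)) (sym (glue-after a′)) (sym (glue-after c′))
                                          (on-after a′ c′ (+-cancelˡ-< j a′ c′ a<c) (+-cancelˡ-< j c′ _ c<j+k))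

glue-realizes : ∀ {f H j k t b y₁ y₂} →
  RealizesAbove f H j t b y₁ → RealizesAbove f H k (λ a c → t (j + a) (j + c)) b y₂ →
  (∀ a c → a < j → c < k → y₁ a < y₂ c × f (y₁ a) (y₂ c) ≡ t a (j + c)) →
  RealizesAbove f H (j + k) t b (glue j y₁ y₂)
glue-realizes {f} {H} {j} {k} {t} {b} R₁ R₂ across = record
  { inH        = glue-elim (λ _ y → H y ≡ true) R₁.inH R₂.inH
  ; above      = glue-elim (λ _ y → b < y) R₁.above R₂.above
  ; increasing = glue-elim₂ (λ _ _ y y′ → y < y′) R₁.increasing
                             (λ a c a<j c<k → proj₁ (across a c a<j c<k)) R₂.increasing
  ; colours    = glue-elim₂ (λ a c y y′ → f y y′ ≡ t a c) R₁.colours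
                             (λ a c a<j c<k → proj₂ (across a c a<j c<k)) R₂.colours
  }
  where
  module R₁ = RealizesAbove R₁
  module R₂ = RealizesAbove R₂

record StronglyRealizesAbove (f : Coloring) (H : ℕ → Bool) (q : Pattern) (N : ℕ) (y : ℕ → ℕ) : Set where
  field
    realizes : RealizesAbove f H (len q ∸ 1) (col q) N y
    limits   : ∀ a → a < len q ∸ 1 → A f (col q a (len q ∸ 1)) (y a)

beyond-limits : ∀ {f : Coloring} m (y : ℕ → ℕ) (c : ℕ → Bool) → (∀ a → a < m → A f (c a) (y a)) →
                Cofinitely (λ z → ∀ a → a < m → y a < z × f (y a) z ≡ c a)
beyond-limits m y c limits = cofinitely-∀< m (λ a a<m → cofinitely-∧ (y a , λ _ y<z → y<z) (limits a a<m))

strong⇒realizes : ∀ {f H q N y} → Infinite H → StronglyRealizesAbove f H q N y →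
                  ∃ (RealizesAbove f H (len q) (col q) N)
strong⇒realizes {q = pat zero    c} _ _ = (λ _ → 0) , realizes-empty
strong⇒realizes {f} {H} {pat (suc m) c} {N} {y} infinite-H S =
  glue m y (λ _ → z) , subst (λ K → RealizesAbove f H K c N (glue m y (λ _ → z))) (+-comm m 1)
    (glue-realizes realizes (realizes-point z∈H N<z) (λ { a _ a<m (s≤s z≤n) → last a a<m }))
  where
  open StronglyRealizesAbove S
  beyond : ∃ λ z → H z ≡ true × (N < z × ∀ a → a < m → y a < z × f (y a) z ≡ c a m)
  beyond = infinite-cofinitely infinite-H
             (cofinitely-∧ (N , λ _ N<z → N<z) (beyond-limits {f} m y (λ a → c a m) limits))
  z : ℕ
  z = proj₁ beyond
  z∈H : H z ≡ true
  z∈H = proj₁ (proj₂ beyond)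
  N<z : N < z
  N<z = proj₁ (proj₂ (proj₂ beyond))
  last : ∀ a → a < m → y a < z × f (y a) z ≡ c a (m + 0)
  last a a<m =
    subst (λ l → y a < z × f (y a) z ≡ c a l) (sym (+-identityʳ m)) (proj₂ (proj₂ (proj₂ beyond)) a a<m)

-- Searching H-computably for realizations

𝟙[_≡_] : ℕ → ℕ → ℕ
𝟙[ a ≡ j ] = 1 ∸ ∣ a - j ∣

𝟙[≡]-yes : ∀ a → 𝟙[ a ≡ a ] ≡ 1
𝟙[≡]-yes a = cong (1 ∸_) (∣n-n∣≡0 a)

𝟙[≡]-no : ∀ {a j} → a ≢ j → 𝟙[ a ≡ j ] ≡ 0
𝟙[≡]-no {a} {j} a≢j with ∣ a - j ∣ in eq
... | zero  = ⊥-elim (a≢j (∣m-n∣≡0⇒m≡n eq))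
... | suc n = 0∸n≡0 n

-- A finite table of arbitrary values is computable: this is how the colours of the pattern, which
-- need not be computable as a function on ℕ, enter the search.
select : ℕ → (ℕ → ℕ) → ℕ → ℕ
select zero    g a = 0
select (suc k) g a = select k g a + 𝟙[ a ≡ k ] * g k

select-above : ∀ k g a → k ≤ a → select k g a ≡ 0
select-above zero    g a _     = refl
select-above (suc k) g a 1+k≤a =
  cong₂ _+_ (select-above k g a (<⇒≤ 1+k≤a)) (cong (_* g k) (𝟙[≡]-no (≢-sym (<⇒≢ 1+k≤a))))

select-lookup : ∀ k g a → a < k → select k g a ≡ g a
select-lookup (suc k) g a a<1+k with a ≟ k
... | yes refl = trans (cong₂ _+_ (select-above a g a ≤-refl) (cong (_* g a) (𝟙[≡]-yes a))) (+-identityʳ (g a))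
... | no  a≢k  = trans (cong₂ _+_ (select-lookup k g a (≤∧≢⇒< (s≤s⁻¹ a<1+k) a≢k))
                                  (cong (_* g k) (𝟙[≡]-no a≢k)))
                       (+-identityʳ (g a))

module _ {O : ℕ → Bool} where

  𝟙[_≡_]ᶜ : ∀ {n} {F₁ F₂ : Fn n} → Computable O n F₁ → Computable O n F₂ →
            Computable O n (λ xs → 𝟙[ F₁ xs ≡ F₂ xs ])
  𝟙[ cF₁ ≡ cF₂ ]ᶜ = constᶜ 1 ∸ᶜ ∣ cF₁ - cF₂ ∣ᶜ

  selectᶜ : ∀ {n} k {G : ℕ → Fn n} {A : Fn n} → (∀ j → Computable O n (G j)) → Computable O n A →
            Computable O n (λ xs → select k (λ j → G j xs) (A xs))
  selectᶜ zero    cG cA = computable-zero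
  selectᶜ (suc k) cG cA = selectᶜ k cG cA +ᶜ 𝟙[ cA ≡ constᶜ k ]ᶜ *ᶜ cG k

bool→ℕ-injective : ∀ {u v} → bool→ℕ u ≡ bool→ℕ v → u ≡ v
bool→ℕ-injective {false} {false} _ = refl
bool→ℕ-injective {true}  {true}  _ = refl

1*n≡0 : ∀ {m n} → m ≡ 1 → m * n ≡ 0 → n ≡ 0
1*n≡0 {n = n} refl 1*n≡0 = trans (sym (+-identityʳ n)) 1*n≡0

1∸n≡0⇒1≤n : ∀ {n} → 1 ∸ n ≡ 0 → 1 ≤ n
1∸n≡0⇒1≤n {suc n} _ = s≤s z≤n

module Defect (f : Coloring) (H : ℕ → Bool) (K : ℕ) (t : ℕ → ℕ → Bool) where

  table : ℕ → ℕ → ℕ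
  table a c = select K (λ j → select K (λ l → bool→ℕ (t j l)) c) a

  outside : ℕ → ℕ → ℕ
  outside b x = (1 ∸ bool→ℕ (H x)) + (1 ∸ (x ∸ b))

  colour-mismatch : ℕ → ℕ → ℕ → ℕ
  colour-mismatch s x y = ∣ bool→ℕ (f x y) - table (rank s x) (rank s y) ∣

  colour-defect : ℕ → ℕ → ℕ → ℕ
  colour-defect s x y = bitℕ s x * bitℕ s y * colour-mismatch s x y

  size-defect : ℕ → ℕ
  size-defect s = ∣ rank s s - K ∣

  membership-defect : ℕ → ℕ → ℕ
  membership-defect s b = ∑< s (λ x → bitℕ s x * outside b x)

  colouring-defect : ℕ → ℕ
  colouring-defect s = ∑< s (λ x → ∑< s (λ d → colour-defect s x (suc (x + d))))

  -- defect s b ≡ 0 says that D_s has K elements, each in H and above b (outside b x ≡ 0 by truncated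
  -- subtraction), and that its elements of ranks a < c, at positions x < x + 1 + d, have colour t a c.
  defect : ℕ → ℕ → ℕ
  defect s b = size-defect s + membership-defect s b + colouring-defect s

  module _ (computable-f : ComputableColoring f) where
    private
      rankᶜ : ∀ {n} {S X : Fn n} → Computable H n S → Computable H n X → Computable H n (λ xs → rank (S xs) (X xs))
      rankᶜ cS cX = compose₂ (∑<ᶜ (bitℕᶜ (argᶜ (# 1)) (argᶜ (# 0)))) cX cS

      -- The code of f is only correct on pairs x < y, so it is only ever run on (x , x + 1 + d).
      colourᶜ : Computable H 2 (λ { (x ∷ d ∷ []) → bool→ℕ (f x (suc (x + d))) })
      colourᶜ = comp (relativise (proj₁ computable-f)) (proj₁ endpoints) , λ { (x ∷ d ∷ []) →
        e-comp (proj₂ endpoints (x ∷ d ∷ [])) (relativise-eval (proj₂ computable-f x (suc (x + d)) (s≤s (m≤m+n x d)))) }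
        where
        endpoints : ComputableVec H 2 2 (λ xs → lookup xs (# 0) ∷ suc (lookup xs (# 0) + lookup xs (# 1)) ∷ [])
        endpoints = argᶜ (# 0) ∷ᶜ sucᶜ (argᶜ (# 0) +ᶜ argᶜ (# 1)) ∷ᶜ []ᶜ

      tableᶜ : ∀ {n} {A C : Fn n} → Computable H n A → Computable H n C → Computable H n (λ xs → table (A xs) (C xs))
      tableᶜ cA cC = selectᶜ K (λ j → selectᶜ K (λ l → constᶜ (bool→ℕ (t j l))) cC) cA

      outsideᶜ : ∀ {n} {B X : Fn n} → Computable H n B → Computable H n X → Computable H n (λ xs → outside (B xs) (X xs))
      outsideᶜ cB cX = (constᶜ 1 ∸ᶜ compose₁ computable-oracle cX) +ᶜ (constᶜ 1 ∸ᶜ (cX ∸ᶜ cB))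

      membership-term : Computable H 3 (λ { (x ∷ s ∷ b ∷ []) → bitℕ s x * outside b x })
      membership-term = computable-cong (λ { (x ∷ s ∷ b ∷ []) → refl })
        (bitℕᶜ (argᶜ (# 1)) (argᶜ (# 0)) *ᶜ outsideᶜ (argᶜ (# 2)) (argᶜ (# 0)))

      colour-term : Computable H 3 (λ { (d ∷ x ∷ s ∷ []) → colour-defect s x (suc (x + d)) })
      colour-term = computable-cong (λ { (d ∷ x ∷ s ∷ []) → refl })
        (bitℕᶜ s x *ᶜ bitℕᶜ s y *ᶜ ∣ compose₂ colourᶜ x d - tableᶜ (rankᶜ s x) (rankᶜ s y) ∣ᶜ)
        where
        d : Computable H 3 (λ xs → lookup xs (# 0))
        d = argᶜ (# 0)
        x : Computable H 3 (λ xs → lookup xs (# 1))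
        x = argᶜ (# 1)
        s : Computable H 3 (λ xs → lookup xs (# 2))
        s = argᶜ (# 2)
        y : Computable H 3 (λ xs → suc (lookup xs (# 1) + lookup xs (# 0)))
        y = sucᶜ (x +ᶜ d)

      colour-row : Computable H 3 (λ { (x ∷ s ∷ b ∷ []) → ∑< s (λ d → colour-defect s x (suc (x + d))) })
      colour-row = computable-cong (λ { (x ∷ s ∷ b ∷ []) → refl })
        (compose₃ (∑<ᶜ colour-term) (argᶜ (# 1)) (argᶜ (# 0)) (argᶜ (# 1)))

    defectᶜ : Computable H 2 (λ xs → defect (lookup xs (# 0)) (lookup xs (# 1)))
    defectᶜ = computable-cong (λ { (s ∷ b ∷ []) → refl })
      (∣ rankᶜ s s - constᶜ K ∣ᶜ +ᶜ compose₃ (∑<ᶜ membership-term) s s b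
                                +ᶜ compose₃ (∑<ᶜ colour-row) s s b)
      where
      s : Computable H 2 (λ xs → lookup xs (# 0))
      s = argᶜ (# 0)
      b : Computable H 2 (λ xs → lookup xs (# 1))
      b = argᶜ (# 1)

  table-lookup : ∀ {a c} → a < K → c < K → table a c ≡ bool→ℕ (t a c)
  table-lookup {a} {c} a<K c<K = trans (select-lookup K _ a a<K) (select-lookup K _ c c<K)

  outside≡0⇒ : ∀ {b x} → outside b x ≡ 0 → H x ≡ true × b < x
  outside≡0⇒ {b} {x} eq =
    in-H (m+n≡0⇒m≡0 _ eq) , ≰⇒> (λ x≤b → <⇒≢ (1∸n≡0⇒1≤n (m+n≡0⇒n≡0 _ eq)) (sym (m≤n⇒m∸n≡0 x≤b)))
    where
    in-H : 1 ∸ bool→ℕ (H x) ≡ 0 → H x ≡ true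
    in-H _ with H x
    ... | true = refl

  inside⇒outside≡0 : ∀ {b x} → H x ≡ true → b < x → outside b x ≡ 0
  inside⇒outside≡0 {b} {x} x∈H b<x =
    cong₂ _+_ (cong (λ h → 1 ∸ bool→ℕ h) x∈H) (m≤n⇒m∸n≡0 (m<n⇒0<n∸m b<x))

  defect≡0⇒conditions : ∀ s b → defect s b ≡ 0 →
    rank s s ≡ K × (∀ x → x < s → bitℕ s x * outside b x ≡ 0) ×
    (∀ x d → x < s → d < s → colour-defect s x (suc (x + d)) ≡ 0)
  defect≡0⇒conditions s b defect≡0 =
    ∣m-n∣≡0⇒m≡n (m+n≡0⇒m≡0 (size-defect s) (m+n≡0⇒m≡0 (size-defect s + membership-defect s b) defect≡0)) ,
    ∑<≡0⇒≡0 (λ x → bitℕ s x * outside b x) s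
      (m+n≡0⇒n≡0 (size-defect s) (m+n≡0⇒m≡0 (size-defect s + membership-defect s b) defect≡0)) ,
    λ x d x<s → ∑<≡0⇒≡0 (λ d → colour-defect s x (suc (x + d))) s
      (∑<≡0⇒≡0 (λ x → ∑< s (λ d → colour-defect s x (suc (x + d)))) s
        (m+n≡0⇒n≡0 (size-defect s + membership-defect s b) defect≡0) x x<s) d

  defect≡0⇒codes : ∀ {s b} → defect s b ≡ 0 → CodesRealization f H K t b s
  defect≡0⇒codes {s} {b} defect≡0 = record
    { points        = y
    ; realizes      = record
      { inH        = λ a a<K → proj₁ (members (y a) (bit-y a a<K))
      ; above      = λ a a<K → proj₂ (members (y a) (bit-y a a<K))
      ; increasing = increasing
      ; colours    = colours
      }
    ; points∈       = λ a a<K → bitℕ≡1⇒∈D {y a} {s} (bit-y a a<K)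
    ; members-above = λ x x∈s → proj₂ (members x (∈D⇒bitℕ≡1 {x} {s} x∈s))
    }
    where
    size : rank s s ≡ K
    size = proj₁ (defect≡0⇒conditions s b defect≡0)

    members : ∀ x → bitℕ s x ≡ 1 → H x ≡ true × b < x
    members x b≡1 = outside≡0⇒ (1*n≡0 b≡1 (proj₁ (proj₂ (defect≡0⇒conditions s b defect≡0)) x (bitℕ≡1⇒< x b≡1)))

    coloured : ∀ x d → bitℕ s x ≡ 1 → bitℕ s (suc (x + d)) ≡ 1 → d < s →
               bool→ℕ (f x (suc (x + d))) ≡ table (rank s x) (rank s (suc (x + d)))
    coloured x d bx by d<s =
      ∣m-n∣≡0⇒m≡n (1*n≡0 (cong₂ _*_ bx by)
                         (proj₂ (proj₂ (defect≡0⇒conditions s b defect≡0)) x d (bitℕ≡1⇒< x bx) d<s))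

    chosen : Σ (ℕ → ℕ) λ y → ∀ a → a < K → bitℕ s (y a) ≡ 1 × rank s (y a) ≡ a
    chosen = rank-enumeration s size

    y : ℕ → ℕ
    y = proj₁ chosen

    bit-y : ∀ a → a < K → bitℕ s (y a) ≡ 1
    bit-y a a<K = proj₁ (proj₂ chosen a a<K)

    rank-y : ∀ a → a < K → rank s (y a) ≡ a
    rank-y a a<K = proj₂ (proj₂ chosen a a<K)

    increasing : ∀ a c → a < c → c < K → y a < y c
    increasing a c a<c c<K =
      rank-cancel-< s (subst₂ _<_ (sym (rank-y a (<-trans a<c c<K))) (sym (rank-y c c<K)) a<c)

    colours : ∀ a c → a < c → c < K → f (y a) (y c) ≡ t a c
    colours a c a<c c<K = bool→ℕ-injective (begin
      bool→ℕ (f (y a) (y c))                         ≡⟨ cong (λ v → bool→ℕ (f (y a) v)) y-split ⟨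
      bool→ℕ (f (y a) (suc (y a + d)))               ≡⟨ coloured (y a) d (bit-y a a<K) bit-yc d<s ⟩
      table (rank s (y a)) (rank s (suc (y a + d)))  ≡⟨ cong₂ table (rank-y a a<K) (trans (cong (rank s) y-split) (rank-y c c<K)) ⟩
      table a c                                      ≡⟨ table-lookup a<K c<K ⟩
      bool→ℕ (t a c)                                 ∎)
      where
      open ≡-Reasoning
      a<K : a < K
      a<K = <-trans a<c c<K
      d : ℕ
      d = y c ∸ suc (y a)
      y-split : suc (y a + d) ≡ y c
      y-split = m+[n∸m]≡n (increasing a c a<c c<K)
      d<s : d < s
      d<s = ≤-<-trans (m∸n≤m (y c) (suc (y a))) (bitℕ≡1⇒< (y c) (bit-y c c<K))
      bit-yc : bitℕ s (suc (y a + d)) ≡ 1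
      bit-yc = subst (λ v → bitℕ s v ≡ 1) (sym y-split) (bit-y c c<K)

  conditions⇒defect≡0 : ∀ s b → rank s s ≡ K → (∀ x → x < s → bitℕ s x * outside b x ≡ 0) →
    (∀ x d → x < s → d < s → colour-defect s x (suc (x + d)) ≡ 0) → defect s b ≡ 0
  conditions⇒defect≡0 s b size members colours = cong₂ _+_
    (cong₂ _+_ (trans (cong ∣_- K ∣ size) (∣n-n∣≡0 K)) (∑<-zeros _ s members))
    (∑<-zeros _ s λ x x<s → ∑<-zeros _ s λ d d<s → colours x d x<s d<s)

  realizationconditions⇒defect≡0 : ∀ {b y} → RealizesAbove f H K t b y → defect (code K y) b ≡ 0
  realizationconditions⇒defect≡0 {b} {y} R = conditions⇒defect≡0 s b rank-code-total members coloured
    where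
    open RealizesAbove R
    open IncreasingCode K y increasing
    s : ℕ
    s = code K y

    members : ∀ x → x < s → bitℕ s x * outside b x ≡ 0
    members x _ with bitℕ≡0⊎bitℕ≡1 s x
    ... | inj₁ b≡0 = cong (_* outside b x) b≡0
    ... | inj₂ b≡1 with code-members K ≤-refl x b≡1
    ...   | a , a<K , refl = cong₂ _*_ b≡1 (inside⇒outside≡0 (inH a a<K) (above a a<K))

    coloured : ∀ x d → x < s → d < s → colour-defect s x (suc (x + d)) ≡ 0
    coloured x d _ _ with bitℕ≡0⊎bitℕ≡1 s x | bitℕ≡0⊎bitℕ≡1 s (suc (x + d))
    ... | inj₁ bx≡0 | _         = cong (λ u → u * bitℕ s (suc (x + d)) * colour-mismatch s x (suc (x + d))) bx≡0
    ... | inj₂ _    | inj₁ by≡0 = cong (_* colour-mismatch s x (suc (x + d)))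
                                       (trans (cong (bitℕ s x *_) by≡0) (*-zeroʳ (bitℕ s x)))
    ... | inj₂ bx≡1 | inj₂ by≡1 with code-members K ≤-refl x bx≡1 | code-members K ≤-refl (suc (x + d)) by≡1
    ...   | a , a<K , refl | c , c<K , yc≡ =
      trans (cong₂ (λ u v → u * v * colour-mismatch s (y a) (suc (y a + d))) bx≡1 by≡1)
            (trans (+-identityʳ _) (m≡n⇒∣m-n∣≡0 (begin
      bool→ℕ (f (y a) (suc (y a + d)))                  ≡⟨ cong (λ v → bool→ℕ (f (y a) v)) yc≡ ⟨
      bool→ℕ (f (y a) (y c))                            ≡⟨ cong bool→ℕ (colours a c a<c c<K) ⟩
      bool→ℕ (t a c)                                    ≡⟨ table-lookup a<K c<K ⟨
      table a c                                         ≡⟨ cong₂ table (rank-code-at a a<K) rank-right ⟨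
      table (rank s (y a)) (rank s (suc (y a + d)))     ∎)))
      where
      open ≡-Reasoning
      rank-right : rank s (suc (y a + d)) ≡ c
      rank-right = trans (cong (rank s) (sym yc≡)) (rank-code-at c c<K)
      a<c : a < c
      a<c = subst₂ _<_ (rank-code-at a a<K) rank-right (rank-strict s bx≡1 (s≤s (m≤m+n (y a) d)))

  realization-search : ComputableColoring f → (∀ b → ∃ (RealizesAbove f H K t b)) →
    Σ (ℕ → ℕ) λ e → Computable H 1 (λ xs → e (lookup xs (# 0))) × ∀ b → CodesRealization f H K t b (e b)
  realization-search computable-f realizable =
    (λ b → e (b ∷ [])) , (c , λ { (b ∷ []) → ok (b ∷ []) }) , λ b → defect≡0⇒codes (e-zero (b ∷ []))
    where
    zeros : ∀ xs → ∃ λ s → defect s (lookup xs (# 0)) ≡ 0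
    zeros (b ∷ []) = let (y , R) = realizable b in code K y , realizationconditions⇒defect≡0 R
    least : Σ (Fn 1) λ F → Computable H 1 F × ∀ xs → defect (F xs) (lookup xs (# 0)) ≡ 0
    least = computable-least-zero (defectᶜ computable-f) zeros
    e : Fn 1
    e = proj₁ least
    c : Code 1
    c = proj₁ (proj₁ (proj₂ least))
    ok : ∀ xs → Eval H c xs (e xs)
    ok = proj₂ (proj₁ (proj₂ least))
    e-zero : ∀ xs → defect (e xs) (lookup xs (# 0)) ≡ 0
    e-zero = proj₂ (proj₂ least)

record 𝓗-Pair (i : Bool) (f : Coloring) (H : ℕ → Bool) (K₁ : ℕ) (t₁ : ℕ → ℕ → Bool)
              (K₂ : ℕ) (t₂ : ℕ → ℕ → Bool) (N : ℕ) : Set where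
  field
    left right     : ℕ → ℕ
    left-realizes  : RealizesAbove f H K₁ t₁ N left
    right-realizes : RealizesAbove f H K₂ t₂ N right
    left-limits    : ∀ a → a < K₁ → A f i (left a)
    right-limits   : ∀ c → c < K₂ → A f (not i) (right c)
    across         : ∀ a c → a < K₁ → c < K₂ → left a < right c × f (left a) (right c) ≡ not i

n≤suc[pred[n]] : ∀ n → n ≤ suc (pred n)
n≤suc[pred[n]] zero    = z≤n
n≤suc[pred[n]] (suc n) = ≤-refl

module _ {f : Coloring} {H : ℕ → Bool} (infinite-H : Infinite H) where

  -- The sets of a bi-array must be non-empty, so an empty tuple is searched for as a single point.
  realizable-nonempty : ∀ {K t} → (∀ b → ∃ (RealizesAbove f H K t b)) →
                        ∀ b → ∃ (RealizesAbove f H (suc (pred K)) t b)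
  realizable-nonempty {zero}  _          b =
    let (z , b<z , z∈H) = infinite-H (suc b) in (λ _ → z) , realizes-point z∈H b<z
  realizable-nonempty {suc K} realizable = realizable

  CodeSearch : ℕ → (ℕ → ℕ → Bool) → Set
  CodeSearch K t = Σ (ℕ → ℕ) λ e → Computable H 1 (λ xs → e (lookup xs (# 0))) ×
                                   ∀ b → CodesRealization f H (suc (pred K)) t b (e b)

  code-search : ∀ {K t} → ComputableColoring f → (∀ b → ∃ (RealizesAbove f H K t b)) → CodeSearch K t
  code-search {K} {t} computable-f realizable =
    Defect.realization-search f H (suc (pred K)) t computable-f (realizable-nonempty realizable)

  𝓗-pair : ∀ {i K₁ t₁ K₂ t₂} → ComputableColoring f → TwoDimHyperimmune H i f →
           (∀ b → ∃ (RealizesAbove f H K₁ t₁ b)) → (∀ b → ∃ (RealizesAbove f H K₂ t₂ b)) →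
           ∀ N → 𝓗-Pair i f H K₁ t₁ K₂ t₂ N
  𝓗-pair {i} {K₁} {t₁} {K₂} {t₂} computable-f hyperimmune realizable₁ realizable₂ N =
    pair-from (code-search computable-f realizable₁) (code-search computable-f realizable₂)
    where
    pair-from : CodeSearch K₁ t₁ → CodeSearch K₂ t₂ → 𝓗-Pair i f H K₁ t₁ K₂ t₂ N
    pair-from (e₁ , e₁-computable , codes₁) (e₂ , e₂-computable , codes₂) =
      pair (hyperimmune E F bi-array (computable₁ E-computable) (computable₂ F-computable))
      where
      module C₁ (b : ℕ) = CodesRealization (codes₁ b)
      module C₂ (b : ℕ) = CodesRealization (codes₂ b)

      E : ℕ → ℕ
      E n = e₁ (n + N)
      F : ℕ → ℕ → ℕ
      F n m = e₂ (m + N)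

      E-computable : Computable H 1 (λ xs → E (lookup xs (# 0)))
      E-computable = compose₁ e₁-computable (argᶜ (# 0) +ᶜ constᶜ N)
      F-computable : Computable H 2 (λ xs → F (lookup xs (# 0)) (lookup xs (# 1)))
      F-computable = compose₁ e₂-computable (argᶜ (# 1) +ᶜ constᶜ N)

      bi-array : BiArray E F
      bi-array = (λ n → C₁.points (n + N) 0 , C₁.points∈ (n + N) 0 (s≤s z≤n))
               , (λ n x x∈ → ≤-<-trans (m≤m+n n N) (C₁.members-above (n + N) x x∈))
               , (λ n m → C₂.points (m + N) 0 , C₂.points∈ (m + N) 0 (s≤s z≤n))
               , (λ n m y y∈ → ≤-<-trans (m≤m+n m N) (C₂.members-above (m + N) y y∈))

      pair : Meets E F i f → 𝓗-Pair i f H K₁ t₁ K₂ t₂ N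
      pair (n , m , separated , in-A₁ , in-A₂ , crossing) = record
        { left           = C₁.points (n + N)
        ; right          = C₂.points (m + N)
        ; left-realizes  = realizes-above-≤ (m≤n+m N n) (realizes-≤ (n≤suc[pred[n]] K₁) (C₁.realizes (n + N)))
        ; right-realizes = realizes-above-≤ (m≤n+m N m) (realizes-≤ (n≤suc[pred[n]] K₂) (C₂.realizes (m + N)))
        ; left-limits    = λ a a<K₁ → in-A₁ _ (∈₁ a a<K₁)
        ; right-limits   = λ c c<K₂ → in-A₂ _ (∈₂ c c<K₂)
        ; across         = λ a c a<K₁ c<K₂ →
                             separated _ _ (∈₁ a a<K₁) (∈₂ c c<K₂) , crossing _ _ (∈₁ a a<K₁) (∈₂ c c<K₂)
        }
        where
        ∈₁ : ∀ a → a < K₁ → C₁.points (n + N) a ∈D E n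
        ∈₁ a a<K₁ = C₁.points∈ (n + N) a (<-≤-trans a<K₁ (n≤suc[pred[n]] K₁))
        ∈₂ : ∀ c → c < K₂ → C₂.points (m + N) c ∈D F n m
        ∈₂ c c<K₂ = C₂.points∈ (m + N) c (<-≤-trans c<K₂ (n≤suc[pred[n]] K₂))

-- Patterns

symcol-< : ∀ p {a b} → a < b → symcol p a b ≡ col p a b
symcol-< p {a} {b} a<b with a <ᵇ b | <⇒<ᵇ a<b
... | true | _ = refl

symcol-> : ∀ p {a b} → b < a → symcol p a b ≡ col p b a
symcol-> p {a} {b} b<a with a <ᵇ b | <ᵇ⇒< a b
... | true  | a<b = ⊥-elim (<-asym (a<b tt) b<a)
... | false | _   = refl

symcol-comm : ∀ p {a b} → a ≢ b → symcol p a b ≡ symcol p b a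
symcol-comm p {a} {b} a≢b with <-cmp a b
... | tri< a<b _ _ = trans (symcol-< p a<b) (sym (symcol-> p a<b))
... | tri≈ _ a≡b _ = ⊥-elim (a≢b a≡b)
... | tri> _ _ b<a = trans (symcol-> p b<a) (sym (symcol-< p b<a))

sub-refl : ∀ q → SubPattern q q
sub-refl q = (λ x → x) , (λ _ x< → x<) , (λ _ _ _ _ eq → eq) , λ _ _ x<y _ → sym (symcol-< q x<y)

sub-trans : ∀ {r q p} → SubPattern r q → SubPattern q p → SubPattern r p
sub-trans {r} {q} {p} (g , g< , g-inj , g-col) (h , h< , h-inj , h-col) =
  (λ x → h (g x)) , (λ x x< → h< (g x) (g< x x<)) ,
  (λ x y x< y< eq → g-inj x y x< y< (h-inj (g x) (g y) (g< x x<) (g< y y<) eq)) ,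
  λ x y x<y y< → trans (g-col x y x<y y<)
    (symcol-along (g< x (<-trans x<y y<)) (g< y y<) (λ eq → <-irrefl (g-inj x y (<-trans x<y y<) y< eq) x<y))
  where
  symcol-along : ∀ {a b} → a < len q → b < len q → a ≢ b → symcol q a b ≡ symcol p (h a) (h b)
  symcol-along {a} {b} a< b< a≢b with <-cmp a b
  ... | tri< a<b _ _ = trans (symcol-< q a<b) (h-col a b a<b b<)
  ... | tri≈ _ a≡b _ = ⊥-elim (a≢b a≡b)
  ... | tri> _ _ b<a = trans (symcol-> q b<a)
                         (trans (h-col b a b<a a<) (symcol-comm p (λ eq → a≢b (sym (h-inj b a b< a< eq)))))

restrict : Pattern → (ℕ → ℕ) → ℕ → Pattern
restrict q g k = pat k (λ a c → col q (g a) (g c))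

restrict-sub : ∀ q g k → (∀ a c → a < c → c < k → g a < g c) → (∀ a → a < k → g a < len q) →
               SubPattern (restrict q g k) q
restrict-sub q g k g-mono g< = g , g< , injective , λ a c a<c c<k → sym (symcol-< q (g-mono a c a<c c<k))
  where
  injective : ∀ a c → a < k → c < k → g a ≡ g c → a ≡ c
  injective a c a<k c<k eq with <-cmp a c
  ... | tri< a<c _ _ = ⊥-elim (<-irrefl eq (g-mono a c a<c c<k))
  ... | tri≈ _ a≡c _ = a≡c
  ... | tri> _ _ c<a = ⊥-elim (<-irrefl (sym eq) (g-mono c a c<a a<k))

Admissible : Bool → Pattern → Set
Admissible i p = ∀ q → 1 ≤ len q → SubPattern q p → Reducible q ⊎ Convergent q ⊎ ¬ Merging i q

admissible-sub : ∀ {i q p} → SubPattern q p → Admissible i p → Admissible i q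
admissible-sub {q = q} {p} q⊑p admissible r 1≤len r⊑q = admissible r 1≤len (sub-trans {r} {q} {p} r⊑q q⊑p)

CrossCut : Pattern → ℕ → Set
CrossCut q j = 1 ≤ j × j < len q ∸ 1 ×
  (∀ a c → a < j → j ≤ c → c < len q ∸ 1 → col q a c ≡ col q a (len q ∸ 1))

join-col-beyond : ∀ p q {a c} → a < len p ∸ 1 → len p ∸ 1 ≤ c → col (p ⊎P q) a c ≡ col p a (len p ∸ 1)
join-col-beyond p q {a} {c} a<j j≤c with c <ᵇ len p | <ᵇ⇒< c (len p)
... | true  | c<len = cong (col p a) (≤-antisym (<⇒≤∸1 (c<len tt)) j≤c)
  where
  <⇒≤∸1 : ∀ {c n} → c < n → c ≤ n ∸ 1
  <⇒≤∸1 {n = suc n} c<1+n = s≤s⁻¹ c<1+n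
... | false | _ with a <ᵇ len p ∸ 1 | <⇒<ᵇ a<j
...   | true | _ = refl

n∸1<n : ∀ {n} → 1 ≤ n → n ∸ 1 < n
n∸1<n {suc n} _ = n<1+n n

reducible⇒cross-cut : ∀ q → Reducible q → ∃ (CrossCut q)
reducible⇒cross-cut q (p₁ , p₂ , 2≤len₁ , 2≤len₂ , len≡ , col≡) = j , 1≤j , j<m , crossing
  where
  m j : ℕ
  m = len q ∸ 1
  j = len p₁ ∸ 1

  len₁≤m : len p₁ ≤ m
  len₁≤m = subst (λ l → len p₁ ≤ l ∸ 1) (sym len≡) (l₁≤l₁+l₂∸1∸1 (len p₁) (len p₂) 2≤len₂)
    where
    l₁≤l₁+l₂∸1∸1 : ∀ l₁ l₂ → 2 ≤ l₂ → l₁ ≤ l₁ + l₂ ∸ 1 ∸ 1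
    l₁≤l₁+l₂∸1∸1 l₁ (suc zero)     (s≤s ())
    l₁≤l₁+l₂∸1∸1 l₁ (suc (suc l₂)) _ =
      subst (λ n → l₁ ≤ n ∸ 1 ∸ 1) (sym (trans (+-suc l₁ (suc l₂)) (cong suc (+-suc l₁ l₂)))) (m≤m+n l₁ l₂)

  1≤j : 1 ≤ j
  1≤j = ∸-monoˡ-≤ 1 2≤len₁

  j<m : j < m
  j<m = <-≤-trans (n∸1<n (<⇒≤ 2≤len₁)) len₁≤m

  via-p₁ : ∀ {a c} → a < j → j ≤ c → c < len q → col q a c ≡ col p₁ a j
  via-p₁ a<j j≤c c<len = trans (col≡ _ _ (<-≤-trans a<j j≤c) c<len) (join-col-beyond p₁ p₂ a<j j≤c)

  crossing : ∀ a c → a < j → j ≤ c → c < m → col q a c ≡ col q a m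
  crossing a c a<j j≤c c<m =
    trans (via-p₁ a<j j≤c (<-≤-trans c<m (m∸n≤m (len q) 1)))
          (sym (via-p₁ a<j (<⇒≤ j<m) (n∸1<n (≤-trans (s≤s z≤n) (<-≤-trans c<m (m∸n≤m (len q) 1))))))

Cut : Bool → Pattern → ℕ → Bool → Set
Cut i q j c = (∀ a → a < j → col q a (len q ∸ 1) ≡ i) ×
              (∀ b → j ≤ b → b < len q ∸ 1 → col q b (len q ∸ 1) ≡ not i) ×
              (∀ a b → a < j → j ≤ b → b < len q ∸ 1 → col q a b ≡ c)

≡not⊎≡ : ∀ u v → u ≡ not v ⊎ u ≡ v
≡not⊎≡ false false = inj₂ refl
≡not⊎≡ false true  = inj₁ refl
≡not⊎≡ true  false = inj₁ refl
≡not⊎≡ true  true  = inj₂ refl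

module _ (i : Bool) (q : Pattern) where
  private
    m : ℕ
    m = len q ∸ 1

  Violation : ℕ → Set
  Violation j = (∃ λ a → a < j × col q a m ≡ not i) ⊎ (∃ λ b → j ≤ b × b < m × col q b m ≡ i) ⊎
                (∃ λ a → ∃ λ b → a < j × j ≤ b × b < m × col q a b ≢ col q 0 j)

  right-or-not : ∀ j b → (j ≤ b × col q b m ≡ i) ⊎ (j ≤ b → col q b m ≡ not i)
  right-or-not j b with j ≤? b | ≡not⊎≡ (col q b m) i
  ... | yes j≤b | inj₂ wrong = inj₁ (j≤b , wrong)
  ... | yes _   | inj₁ right = inj₂ (λ _ → right)
  ... | no  j≰b | _          = inj₂ (λ j≤b → ⊥-elim (j≰b j≤b))

  crossing-or-not : ∀ j a → (∃ λ b → b < m × j ≤ b × col q a b ≢ col q 0 j) ⊎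
                            (∀ b → b < m → j ≤ b → col q a b ≡ col q 0 j)
  crossing-or-not j a with first-or-all decide m
    where
    decide : ∀ b → (j ≤ b × col q a b ≢ col q 0 j) ⊎ (j ≤ b → col q a b ≡ col q 0 j)
    decide b with j ≤? b | col q a b ≟ᵇ col q 0 j
    ... | yes j≤b | no  wrong = inj₁ (j≤b , wrong)
    ... | yes _   | yes right = inj₂ (λ _ → right)
    ... | no  j≰b | _         = inj₂ (λ j≤b → ⊥-elim (j≰b j≤b))
  ... | inj₁ (b , b<m , wrong , _) = inj₁ (b , b<m , wrong)
  ... | inj₂ right                 = inj₂ right

  cut-or-violation : ∀ j → Cut i q j (col q 0 j) ⊎ Violation j
  cut-or-violation j with first-or-all (λ a → ≡not⊎≡ (col q a m) i) j
  ... | inj₁ (a , a<j , wrong , _) = inj₂ (inj₁ (a , a<j , wrong))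
  ... | inj₂ left-i with first-or-all (right-or-not j) m
  ...   | inj₁ (b , b<m , (j≤b , wrong) , _) = inj₂ (inj₂ (inj₁ (b , j≤b , b<m , wrong)))
  ...   | inj₂ right-not-i with first-or-all (crossing-or-not j) j
  ...     | inj₁ (a , a<j , (b , b<m , j≤b , wrong) , _) = inj₂ (inj₂ (inj₂ (a , b , a<j , j≤b , b<m , wrong)))
  ...     | inj₂ crossing = inj₁ (left-i , (λ b j≤b b<m → right-not-i b b<m j≤b) ,
                                  (λ a b a<j j≤b b<m → crossing a a<j b b<m j≤b))

false-upward-closed : ∀ (F : ℕ → Bool) {m j} → (∀ x y → (x < m × F x ≡ true) → (y < m × F y ≡ false) → x < y) →
             j < m → F j ≡ false → ∀ b → j ≤ b → b < m → F b ≡ false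
false-upward-closed F separated j<m Fj≡false b j≤b b<m with F b in Fb
... | false = refl
... | true  = ⊥-elim (<⇒≱ (separated b _ (b<m , Fb) (j<m , Fj≡false)) j≤b)

¬merging⇒cut : ∀ i q → ¬ Merging i q → ∃ λ j → 1 ≤ j × j < len q ∸ 1 × Cut i q j (col q 0 j)
¬merging⇒cut i q ¬merging with first-or-all cut-at (len q ∸ 1)
  where
  cut-at : ∀ j → (1 ≤ j × Cut i q j (col q 0 j)) ⊎ (1 ≤ j → Violation i q j)
  cut-at zero    = inj₂ (λ ())
  cut-at (suc j) with cut-or-violation i q (suc j)
  ... | inj₁ cut       = inj₁ (s≤s z≤n , cut)
  ... | inj₂ violation = inj₂ (λ _ → violation)
... | inj₁ (j , j<m , (1≤j , cut) , _) = j , 1≤j , j<m , cut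
... | inj₂ violations = ⊥-elim (¬merging merging)
  where
  true-or-false : ∀ b → b ≡ false ⊎ b ≡ true
  true-or-false false = inj₁ refl
  true-or-false true  = inj₂ refl

  -- The partition F ⊔ G is cut at the least element j of G; the violation of Cut at j is the witness.
  merging : Merging i q
  merging F (x₀ , x₀<m , Fx₀) (y₀ , y₀<m , Fy₀) separated with first-or-all (λ y → true-or-false (F y)) (len q ∸ 1)
  ... | inj₂ all-true with () ← trans (sym (all-true y₀ y₀<m)) Fy₀
  ... | inj₁ (j , j<m , Fj , before-j)
        with violations j j<m (≤-trans (s≤s z≤n) (separated x₀ j (x₀<m , Fx₀) (j<m , Fj)))
  ...   | inj₁ (a , a<j , wrong) = inj₁ (a , (<-trans a<j j<m , before-j a a<j) , wrong)
  ...   | inj₂ (inj₁ (b , j≤b , b<m , wrong)) =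
          inj₂ (inj₁ (b , (b<m , false-upward-closed F separated j<m Fj b j≤b b<m) , wrong))
  ...   | inj₂ (inj₂ (a , b , a<j , j≤b , b<m , wrong)) =
          inj₂ (inj₂ (a , 0 , b , j , (<-trans a<j j<m , before-j a a<j) , (<-trans 0<j j<m , before-j 0 0<j) ,
                      (b<m , false-upward-closed F separated j<m Fj b j≤b b<m) , (j<m , Fj) , wrong))
    where
    0<j : 0 < j
    0<j = ≤-<-trans z≤n a<j

-- q restricted to the points before j together with its last point
prefix⁺ : Pattern → ℕ → Pattern
prefix⁺ q j = restrict q (glue j (λ a → a) (λ _ → len q ∸ 1)) (suc j)

shifted : Pattern → ℕ → ℕ → Pattern
shifted q j k = restrict q (j +_) k

glue-at : ∀ {j y₁ y₂} → glue j y₁ y₂ j ≡ y₂ 0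
glue-at {j} {y₁} {y₂} = trans (cong (glue j y₁ y₂) (sym (+-identityʳ j))) (glue-after {j} {y₁} {y₂} 0)

prefix⁺-sub : ∀ q j → j < len q ∸ 1 → SubPattern (prefix⁺ q j) q
prefix⁺-sub q j j<m = restrict-sub q g (suc j) mono bounded
  where
  m : ℕ
  m = len q ∸ 1
  g : ℕ → ℕ
  g = glue j (λ a → a) (λ _ → m)
  g-before : ∀ {a} → a < j → g a ≡ a
  g-before = glue-before {j} {λ a → a} {λ _ → m}
  g-at : g j ≡ m
  g-at = glue-at {j} {λ a → a} {λ _ → m}
  m<len : m < len q
  m<len = n∸1<n (≤-trans (s≤s z≤n) (<-≤-trans j<m (m∸n≤m (len q) 1)))
  mono : ∀ a c → a < c → c < suc j → g a < g c
  mono a c a<c c<1+j with m≤n⇒m<n∨m≡n (s≤s⁻¹ c<1+j)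
  ... | inj₁ c<j  = subst₂ _<_ (sym (g-before (<-trans a<c c<j))) (sym (g-before c<j)) a<c
  ... | inj₂ refl = subst₂ _<_ (sym (g-before a<c)) (sym g-at) (<-trans a<c j<m)
  bounded : ∀ a → a < suc j → g a < len q
  bounded a a<1+j with m≤n⇒m<n∨m≡n (s≤s⁻¹ a<1+j)
  ... | inj₁ a<j  = subst (_< len q) (sym (g-before a<j)) (<-trans a<j (<-trans j<m m<len))
  ... | inj₂ refl = subst (_< len q) (sym g-at) m<len

shifted-sub : ∀ q j k → j + k ≤ len q → SubPattern (shifted q j k) q
shifted-sub q j k j+k≤len = restrict-sub q (j +_) k (λ a c a<c _ → +-monoʳ-< j a<c)
                                            (λ a a<k → <-≤-trans (+-monoʳ-< j a<k) j+k≤len)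

-- The induction on the length of the pattern

module _ {f : Coloring} {H : ℕ → Bool} where

  strong-trivial : ∀ {q N y} → len q ∸ 1 ≡ 0 → StronglyRealizesAbove f H q N y
  strong-trivial {q} {N} {y} m≡0 = record
    { realizes = subst (λ K → RealizesAbove f H K (col q) N y) (sym m≡0) realizes-empty
    ; limits   = λ a a<m → ⊥-elim (n≮0 (subst (a <_) m≡0 a<m))
    }

  strong-glue : ∀ {q N j y₁ y₂} → j ≤ len q ∸ 1 →
    RealizesAbove f H j (col q) N y₁ → RealizesAbove f H (len q ∸ 1 ∸ j) (col (shifted q j (len q ∸ 1 ∸ j))) N y₂ →
    (∀ a c → a < j → c < len q ∸ 1 ∸ j → y₁ a < y₂ c × f (y₁ a) (y₂ c) ≡ col q a (j + c)) →
    (∀ a → a < j → A f (col q a (len q ∸ 1)) (y₁ a)) →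
    (∀ c → c < len q ∸ 1 ∸ j → A f (col q (j + c) (len q ∸ 1)) (y₂ c)) →
    StronglyRealizesAbove f H q N (glue j y₁ y₂)
  strong-glue {q} {N} {j} {y₁} {y₂} j≤m R₁ R₂ across limits₁ limits₂ = record
    { realizes = subst (λ K → RealizesAbove f H K (col q) N (glue j y₁ y₂)) j+k≡m (glue-realizes R₁ R₂ across)
    ; limits   = λ a a<m →
        glue-elim (λ a y → A f (col q a (len q ∸ 1)) y) limits₁ limits₂ a (subst (a <_) (sym j+k≡m) a<m)
    }
    where
    j+k≡m : j + (len q ∸ 1 ∸ j) ≡ len q ∸ 1
    j+k≡m = m+[n∸m]≡n j≤m

  strong-of-cross-cut : ∀ {q j} → CrossCut q j →
    (∀ N → ∃ (StronglyRealizesAbove f H (prefix⁺ q j) N)) →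
    (∀ N → ∃ (StronglyRealizesAbove f H (shifted q j (suc (len q ∸ 1 ∸ j))) N)) →
    ∀ N → ∃ (StronglyRealizesAbove f H q N)
  strong-of-cross-cut {q} {j} (_ , j<m , crossing) strong₁ strong₂ N =
    glue j x₁ x₂ , strong-glue (<⇒≤ j<m) R₁ (realizes-above-≤ (m≤m⊔n N M) S₂.realizes) across limits₁ limits₂
    where
    m : ℕ
    m = len q ∸ 1
    x₁ : ℕ → ℕ
    x₁ = proj₁ (strong₁ N)
    module S₁ = StronglyRealizesAbove (proj₂ (strong₁ N))
    g-before : ∀ {a} → a < j → glue j (λ a → a) (λ _ → m) a ≡ a
    g-before = glue-before {j} {λ a → a} {λ _ → m}
    g-at : glue j (λ a → a) (λ _ → m) j ≡ m
    g-at = glue-at {j} {λ a → a} {λ _ → m}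

    R₁ : RealizesAbove f H j (col q) N x₁
    R₁ = realizes-cong (λ a c a<c c<j → cong₂ (col q) (g-before (<-trans a<c c<j)) (g-before c<j)) S₁.realizes
    limits₁ : ∀ a → a < j → A f (col q a m) (x₁ a)
    limits₁ a a<j = subst (λ b → A f b (x₁ a)) (cong₂ (col q) (g-before a<j) g-at) (S₁.limits a a<j)

    beyond : Cofinitely (λ y → ∀ a → a < j → x₁ a < y × f (x₁ a) y ≡ col q a m)
    beyond = beyond-limits {f} j x₁ (λ a → col q a m) limits₁
    M : ℕ
    M = proj₁ beyond
    x₂ : ℕ → ℕ
    x₂ = proj₁ (strong₂ (N ⊔ M))
    module S₂ = StronglyRealizesAbove (proj₂ (strong₂ (N ⊔ M)))

    across : ∀ a c → a < j → c < m ∸ j → x₁ a < x₂ c × f (x₁ a) (x₂ c) ≡ col q a (j + c)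
    across a c a<j c<k =
      let (x₁<x₂ , colour) = proj₂ beyond (x₂ c) (m⊔n<o⇒n<o N M (RealizesAbove.above S₂.realizes c c<k)) a a<j
      in x₁<x₂ , trans colour (sym (crossing a (j + c) a<j (m≤m+n j c) j+c<m))
      where
      j+c<m : j + c < m
      j+c<m = subst (j + c <_) (m+[n∸m]≡n (<⇒≤ j<m)) (+-monoʳ-< j c<k)
    limits₂ : ∀ c → c < m ∸ j → A f (col q (j + c) m) (x₂ c)
    limits₂ c c<k = subst (λ l → A f (col q (j + c) l) (x₂ c)) (m+[n∸m]≡n (<⇒≤ j<m)) (S₂.limits c c<k)

  strong-of-cut : ∀ {i q j} → Infinite H → ComputableColoring f → TwoDimHyperimmune H i f →
    j ≤ len q ∸ 1 → Cut i q j (not i) →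
    (∀ N → ∃ (RealizesAbove f H j (col q) N)) →
    (∀ N → ∃ (RealizesAbove f H (len q ∸ 1 ∸ j) (col (shifted q j (len q ∸ 1 ∸ j))) N)) →
    ∀ N → ∃ (StronglyRealizesAbove f H q N)
  strong-of-cut {i} {q} {j} infinite-H computable-f hyperimmune j≤m (left-i , right-not-i , crossing)
                realizable₁ realizable₂ N =
    glue j left right , strong-glue j≤m left-realizes right-realizes across′ limits₁ limits₂
    where
    open 𝓗-Pair (𝓗-pair infinite-H computable-f hyperimmune realizable₁ realizable₂ N)
    m : ℕ
    m = len q ∸ 1
    j+c<m : ∀ {c} → c < m ∸ j → j + c < m
    j+c<m {c} c<k = subst (j + c <_) (m+[n∸m]≡n j≤m) (+-monoʳ-< j c<k)
    across′ : ∀ a c → a < j → c < m ∸ j → left a < right c × f (left a) (right c) ≡ col q a (j + c)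
    across′ a c a<j c<k = proj₁ (across a c a<j c<k) ,
                          trans (proj₂ (across a c a<j c<k)) (sym (crossing a (j + c) a<j (m≤m+n j c) (j+c<m c<k)))
    limits₁ : ∀ a → a < j → A f (col q a m) (left a)
    limits₁ a a<j = subst (λ b → A f b (left a)) (sym (left-i a a<j)) (left-limits a a<j)
    limits₂ : ∀ c → c < m ∸ j → A f (col q (j + c) m) (right c)
    limits₂ c c<k =
      subst (λ b → A f b (right c)) (sym (right-not-i (j + c) (m≤m+n j c) (j+c<m c<k))) (right-limits c c<k)

module _ (i : Bool) {f : Coloring} (computable-f : ComputableColoring f)
         {H : ℕ → Bool} (infinite-H : Infinite H) (hyperimmune : TwoDimHyperimmune H i f) where

  strongly-realizable : ∀ n q → len q ≤ n → Admissible i q → ∀ N → ∃ (StronglyRealizesAbove f H q N)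
  strongly-realizable zero    q len≤0   _          N = (λ _ → 0) , strong-trivial (cong (_∸ 1) (n≤0⇒n≡0 len≤0))
  strongly-realizable (suc n) q len≤1+n admissible N with 1 ≤? len q ∸ 1
  ... | no  m≱1 = (λ _ → 0) , strong-trivial (n<1⇒n≡0 (≰⇒> m≱1))
  ... | yes m≥1 = by-cases (admissible q (≤-trans m≥1 (m∸n≤m (len q) 1)) (sub-refl q)) N
    where
    m : ℕ
    m = len q ∸ 1

    strong : ∀ r → len r ≤ m → SubPattern r q → ∀ N → ∃ (StronglyRealizesAbove f H r N)
    strong r len≤m r⊑q =
      strongly-realizable n r (≤-trans len≤m (∸-monoˡ-≤ 1 len≤1+n)) (admissible-sub {q = r} {q} r⊑q admissible)

    realizable : ∀ r → len r ≤ m → SubPattern r q → ∀ N → ∃ (RealizesAbove f H (len r) (col r) N)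
    realizable r len≤m r⊑q N = strong⇒realizes infinite-H (proj₂ (strong r len≤m r⊑q N))

    m<len : m < len q
    m<len = n∸1<n (≤-trans m≥1 (m∸n≤m (len q) 1))

    via-cross-cut : ∀ {j} → CrossCut q j → ∀ N → ∃ (StronglyRealizesAbove f H q N)
    via-cross-cut {j} cut@(j≥1 , j<m , _) = strong-of-cross-cut cut
      (strong (prefix⁺ q j) j<m (prefix⁺-sub q j j<m))
      (strong (shifted q j (suc (m ∸ j))) (∸-monoʳ-< j≥1 (<⇒≤ j<m)) (shifted-sub q j (suc (m ∸ j)) j+1+[m∸j]≤len))
      where
      j+1+[m∸j]≤len : j + suc (m ∸ j) ≤ len q
      j+1+[m∸j]≤len = subst (_≤ len q) (sym (+-suc j (m ∸ j))) (subst (_< len q) (sym (m+[n∸m]≡n (<⇒≤ j<m))) m<len)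

    via-cut : ∀ {j} → j ≤ m → Cut i q j (not i) → ∀ N → ∃ (StronglyRealizesAbove f H q N)
    via-cut {j} j≤m cut = strong-of-cut infinite-H computable-f hyperimmune j≤m cut
      (realizable (shifted q 0 j) j≤m (shifted-sub q 0 j (≤-trans j≤m (<⇒≤ m<len))))
      (realizable (shifted q j (m ∸ j)) (m∸n≤m m j)
                  (shifted-sub q j (m ∸ j) (subst (_≤ len q) (sym (m+[n∸m]≡n j≤m)) (<⇒≤ m<len))))

    by-cases : Reducible q ⊎ Convergent q ⊎ ¬ Merging i q → ∀ N → ∃ (StronglyRealizesAbove f H q N)
    by-cases (inj₁ reducible) = via-cross-cut (proj₂ (reducible⇒cross-cut q reducible))
    by-cases (inj₂ (inj₁ convergent)) with ≡not⊎≡ (col q 0 m) i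
    ... | inj₂ all-i     = via-cut ≤-refl
      ((λ a a<m → trans (convergent a 0 a<m m≥1) all-i) ,
       (λ b m≤b b<m → ⊥-elim (<⇒≱ b<m m≤b)) , (λ a b a<m m≤b b<m → ⊥-elim (<⇒≱ b<m m≤b)))
    ... | inj₁ all-not-i = via-cut z≤n
      ((λ _ ()) , (λ b _ b<m → trans (convergent b 0 b<m m≥1) all-not-i) , (λ _ _ ()))
    by-cases (inj₂ (inj₂ ¬merging)) with ¬merging⇒cut i q ¬merging
    ... | j , j≥1 , j<m , left-i , right-not-i , crossing with ≡not⊎≡ (col q 0 j) i
    ...   | inj₁ not-i = via-cut (<⇒≤ j<m)
                           (left-i , right-not-i , λ a b a<j j≤b b<m → trans (crossing a b a<j j≤b b<m) not-i)
    ...   | inj₂ is-i  = via-cross-cut (j≥1 , j<m , λ a b a<j j≤b b<m →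
                           trans (crossing a b a<j j≤b b<m) (trans is-i (sym (left-i a a<j))))

theorem5p23 : (i : Bool) (p : Pattern) → len p ≥ 2 →
    (∀ q → 1 ≤ len q → SubPattern q p → Reducible q ⊎ Convergent q ⊎ ¬ Merging i q) →
    (f : Coloring) → Stable f → ComputableColoring f →
    (H : ℕ → Bool) → Infinite H → TwoDimHyperimmune H i f →
    StronglyAppears p f H
theorem5p23 i p _ admissible f _ computable-f H infinite-H hyperimmune =
  let (x , S) = strongly-realizable i computable-f infinite-H hyperimmune (len p) p ≤-refl admissible 0
      open StronglyRealizesAbove S
      open RealizesAbove realizes
  in x , inH , increasing , colours , limits
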